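{- Let $s\ge 2$ be an integer and let $G$ be a graph containing no copy of $K_{2,s+1}$ and no copy of $C_6$. Let $v\in V(G)$ and let $N_G(v)$ be its neighborhood. Then the number of copies of $C_4$ in $G$ containing $v$ is at most \[ \max\left(3\,|N_G(v)|,\ \frac{(s-1)(s+2)}{2(s+1)}\,|N_G(v)|\right). \] If in addition $G$ contains no copy of $K_5$, then the number of copies of $C_4$ in $G$ containing $v$ is at most \[ \max\left(2\,|N_G(v)|,\ \frac{(s-1)(s+2)}{2(s+1)}\,|N_G(v)|\right). \]
   Context: $C_k$ denotes the cycle on $k$ vertices, $K_k$ the complete graph on $k$ vertices, and $K_{a,b}$ the complete bipartite graph with parts of sizes $a$ and $b$. A copy of $H$ in $G$ is a (not necessarily induced) subgraph of $G$ isomorphic to $H$. -}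

module Defs where

open import Data.Bool using (Bool; true; false; _∧_; _∨_; not; _xor_)
open import Data.Nat using (ℕ; zero; suc; _+_; _*_; _<ᵇ_; _≡ᵇ_; _/_)
open import Data.Fin using (Fin; toℕ)
open import Data.Fin.Properties using (_≟_)
open import Data.List using (List; allFin; filterᵇ; length; concatMap; map)
open import Data.Product using (Σ; _×_; _,_)
open import Function.Definitions using (Injective)
open import Relation.Binary.PropositionalEquality using (_≡_)
open import Relation.Nullary.Decidable using (⌊_⌋)

record Graph : Set where
  field
    n     : ℕ
    adj   : Fin n → Fin n → Bool
    sym   : ∀ i j → adj i j ≡ adj j i
    irrefl : ∀ i → adj i i ≡ false
open Graph public

Contains : {k : ℕ} → (Fin k → Fin k → Bool) → Graph → Set
Contains {k} H G =
  Σ (Fin k → Fin (n G)) λ f →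
    Injective _≡_ _≡_ f × (∀ i j → H i j ≡ true → adj G (f i) (f j) ≡ true)

-- K_{2,t} on Fin (2 + t): vertices 0,1 form one side.
K2 : (t : ℕ) → Fin (2 + t) → Fin (2 + t) → Bool
K2 t i j = (toℕ i <ᵇ 2) xor (toℕ j <ᵇ 2)

K : (k : ℕ) → Fin k → Fin k → Bool
K k i j = not ⌊ i ≟ j ⌋

C6 : Fin 6 → Fin 6 → Bool
C6 i j = step (toℕ i) (toℕ j) ∨ step (toℕ j) (toℕ i)
  where
  step : ℕ → ℕ → Bool
  step a b = ((suc a) ≡ᵇ b) ∨ ((a ≡ᵇ 5) ∧ (b ≡ᵇ 0))

degree : (G : Graph) → Fin (n G) → ℕ
degree G v = length (filterᵇ (adj G v) (allFin (n G)))

quads : (m : ℕ) → List (Fin m × Fin m × Fin m × Fin m)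
quads m = concatMap (λ a → concatMap (λ b → concatMap (λ c → map (λ d → (a , b , c , d))
            (allFin m)) (allFin m)) (allFin m)) (allFin m)

isC4Through : (G : Graph) → Fin (n G) → Fin (n G) × Fin (n G) × Fin (n G) × Fin (n G) → Bool
isC4Through G v (a , b , c , d) =
  distinct ∧ adj G a b ∧ adj G b c ∧ adj G c d ∧ adj G d a ∧
  (eq v a ∨ eq v b ∨ eq v c ∨ eq v d)
  where
  eq : Fin (n G) → Fin (n G) → Bool
  eq x y = ⌊ x ≟ y ⌋
  distinct : Bool
  distinct = not (eq a b ∨ eq a c ∨ eq a d ∨ eq b c ∨ eq b d ∨ eq c d)

-- Number of copies of C_4 in G containing v:
-- (number of injective homomorphisms C_4 → G with v in the image) / |Aut(C_4)|,
-- where |Aut(C_4)| = 8.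
c4Count : (G : Graph) → Fin (n G) → ℕ
c4Count G v = length (filterᵇ (isC4Through G v) (quads (n G))) / 8

{-# OPTIONS --safe #-}
module Submission where

-- Let Φ(X) = Σ_{w ≠ v} C(|X ∩ N(w)|, 2) for X ⊆ N(v). A 4-cycle through v consists of v, its
-- antipode c and two common neighbours of v and c, so the number of 4-cycles through v is at
-- most Φ(N(v)). Put M = max(2j(s+1), (s−1)(s+2)), with j = 3 in general and j = 2 when G has
-- no K₅; we show 2(s+1)Φ(X) ≤ M|X| by induction on |X|. If some w ≠ v has two neighbours in X,
-- choose u ≠ v maximising |X ∩ N(u)|, preferring u ∈ X, and delete T = X ∩ N(u) (together with
-- u when u ∈ X, and in one case a further vertex). K_{2,s+1}-freeness bounds every codegree by
-- s. C₆-freeness keeps the loss small elsewhere: a vertex w with X-neighbours y ∈ T and x′ ≠ y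
-- closes the hexagon v x u y w x′ with almost any further x ∈ X ∩ N(u). Hence Φ drops by at
-- most some D with 2(s+1)D ≤ M|X ∩ T|; the cases are u ∈ X or not, and |X ∩ N(u)| = 2, 3, ≥ 4.

open import Defs hiding (sym)
open import Data.Bool using (Bool; true; false; _∧_; _∨_; not; if_then_else_)
open import Data.Bool.Properties using (∧-conicalˡ; ∧-conicalʳ)
open import Data.Nat using (ℕ; zero; suc; _+_; _*_; _∸_; _≤_; _<_; _⊔_; _/_; z≤n; s≤s; _≤?_; _<?_) renaming (_≟_ to _≟ℕ_)
open import Data.Nat.Properties hiding (_≟_)
open import Algebra.Properties.Semiring.Sum +-*-semiring using (sum; sum-cong-≗; ∑-distrib-+; ∑-comm; sum-replicate-zero; *-distribˡ-sum)
open import Data.Nat.DivMod using (m*n/n≡m; /-monoˡ-≤)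
open import Data.Nat.Solver using (module +-*-Solver)
open +-*-Solver using (solve; _:+_; _:*_; _:=_; con)
open import Data.Fin using (Fin; zero; suc)
open import Data.Fin.Properties using (_≟_)
open import Data.Vec as Vec using (Vec; []; _∷_; lookup)
open import Data.Vec.Properties using (lookup∘tabulate)
open import Data.Vec.Relation.Unary.All using ([]; _∷_)
open import Data.Vec.Relation.Unary.AllPairs using ([]; _∷_)
open import Data.Vec.Relation.Unary.Unique.Propositional using (Unique)
open import Data.Vec.Relation.Unary.Unique.Propositional.Properties using (lookup-injective)
open import Data.List using (List; []; _∷_; _++_; length; filterᵇ; concatMap; map; allFin; tabulate)
open import Data.Product using (Σ; _×_; _,_; proj₁; proj₂)
open import Data.Sum using (_⊎_; inj₁; inj₂; map₁)
open import Data.Empty using (⊥; ⊥-elim)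
open import Function.Definitions using (Injective)
open import Relation.Nullary using (¬_; yes; no)
open import Relation.Nullary.Decidable using (⌊_⌋)
open import Relation.Binary.PropositionalEquality using (_≡_; _≢_; refl; sym; trans; cong; cong₂; subst; subst₂; ≢-sym; module ≡-Reasoning)

-- Finite sums and counting over Fin

sum-mono-≤ : ∀ {m} {f g : Fin m → ℕ} → (∀ i → f i ≤ g i) → sum f ≤ sum g
sum-mono-≤ {zero} h = z≤n
sum-mono-≤ {suc m} h = +-mono-≤ (h zero) (sum-mono-≤ (λ i → h (suc i)))

δ : ∀ {m} → Fin m → Fin m → ℕ → ℕ
δ a i x = if ⌊ i ≟ a ⌋ then x else 0

sum-δ : ∀ {m} (a : Fin m) (x : ℕ) → sum (λ i → δ a i x) ≡ x
sum-δ {suc m} zero x = trans (cong (x +_) (sum-replicate-zero m)) (+-identityʳ x)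
sum-δ {suc m} (suc a) x = trans (sum-cong-≗ h) (sum-δ a x)
  where
  h : ∀ i → δ (suc a) (suc i) x ≡ δ a i x
  h i with i ≟ a
  ... | yes _ = refl
  ... | no _ = refl

δ-≢ : ∀ {m} {u w : Fin m} (c : ℕ) → w ≢ u → δ u w c ≡ 0
δ-≢ {u = u} {w} c ne with w ≟ u
... | yes p = ⊥-elim (ne p)
... | no _ = refl

δ-≡ : ∀ {m} (u : Fin m) (c : ℕ) → δ u u c ≡ c
δ-≡ u c with u ≟ u
... | yes _ = refl
... | no q = ⊥-elim (q refl)

≤δ-at : ∀ {m} {u : Fin m} {x c : ℕ} (h : ℕ) → x ≤ c → x ≤ δ u u c + h
≤δ-at {u = u} {c = c} h le rewrite δ-≡ u c = ≤-trans le (m≤m+n c h)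

≤δ-off : ∀ {m} {u w : Fin m} {x : ℕ} (c h : ℕ) → w ≢ u → x ≤ h → x ≤ δ u w c + h
≤δ-off c h ne le rewrite δ-≢ c ne = le

sum-δ-+ : ∀ {m} (u : Fin m) (c : ℕ) (h : Fin m → ℕ) → sum (λ w → δ u w c + h w) ≡ c + sum h
sum-δ-+ u c h = trans (∑-distrib-+ (λ w → δ u w c) h) (cong (_+ sum h) (sum-δ u c))

∧-intro : ∀ {a b} → a ≡ true → b ≡ true → a ∧ b ≡ true
∧-intro refl refl = refl

∨-elim : ∀ {a b} → a ∨ b ≡ true → a ≡ true ⊎ b ≡ true
∨-elim {true} h = inj₁ refl
∨-elim {false} h = inj₂ h

∨-introˡ : ∀ {a b} → a ≡ true → a ∨ b ≡ true
∨-introˡ refl = refl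

∨-introʳ : ∀ {a b} → b ≡ true → a ∨ b ≡ true
∨-introʳ {true} h = refl
∨-introʳ {false} h = h

not-elim : ∀ {a} → not a ≡ true → a ≡ false
not-elim {false} h = refl

not-intro : ∀ {a} → a ≡ false → not a ≡ true
not-intro refl = refl

true≢false : ∀ {a} → a ≡ true → a ≡ false → ⊥
true≢false refl ()

true⊎false : ∀ a → a ≡ true ⊎ a ≡ false
true⊎false true = inj₁ refl
true⊎false false = inj₂ refl

∧-false⇒false : ∀ a c → a ≡ true → a ∧ c ≡ false → c ≡ false
∧-false⇒false true c _ h = h

∧∧-false⇒false : ∀ a b c → a ≡ true → b ≡ true → a ∧ b ∧ c ≡ false → c ≡ false
∧∧-false⇒false true true c _ _ h = h

eqb : ∀ {m} → Fin m → Fin m → Bool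
eqb x y = ⌊ x ≟ y ⌋

eqb⇒≡ : ∀ {m} {x y : Fin m} → eqb x y ≡ true → x ≡ y
eqb⇒≡ {x = x} {y} h with x ≟ y
... | yes p = p

eqb-refl : ∀ {m} (x : Fin m) → eqb x x ≡ true
eqb-refl x with x ≟ x
... | yes _ = refl
... | no q = ⊥-elim (q refl)

≢⇒eqb-false : ∀ {m} {x y : Fin m} → x ≢ y → eqb x y ≡ false
≢⇒eqb-false {x = x} {y} h with x ≟ y
... | yes p = ⊥-elim (h p)
... | no _ = refl

eqb-false⇒≢ : ∀ {m} {x y : Fin m} → eqb x y ≡ false → x ≢ y
eqb-false⇒≢ {x = x} {y} h p with x ≟ y
... | no q = q p

≡⇒eqb : ∀ {m} {x y : Fin m} → x ≡ y → eqb x y ≡ true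
≡⇒eqb {x = x} refl = eqb-refl x

eqb-comm : ∀ {m} (x y : Fin m) → eqb x y ≡ eqb y x
eqb-comm x y with x ≟ y | y ≟ x
... | yes _ | yes _ = refl
... | no _ | no _ = refl
... | yes p | no q = ⊥-elim (q (sym p))
... | no p | yes q = ⊥-elim (p (sym q))

≡⊎≢ : ∀ {m} (x y : Fin m) → (x ≡ y) ⊎ (x ≢ y)
≡⊎≢ x y with x ≟ y
... | yes p = inj₁ p
... | no q = inj₂ q

fromBool : Bool → ℕ
fromBool true = 1
fromBool false = 0

fromBool≤1 : ∀ b → fromBool b ≤ 1
fromBool≤1 true = s≤s z≤n
fromBool≤1 false = z≤n

count : ∀ {m} → (Fin m → Bool) → ℕ
count P = sum (λ i → fromBool (P i))

count-ext : ∀ {m} (P Q : Fin m → Bool) → (∀ i → P i ≡ Q i) → count P ≡ count Q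
count-ext P Q h = sum-cong-≗ (λ i → cong fromBool (h i))

fromBool-mono : ∀ {a b} → (a ≡ true → b ≡ true) → fromBool a ≤ fromBool b
fromBool-mono {false} h = z≤n
fromBool-mono {true} h rewrite h refl = s≤s z≤n

count-mono : ∀ {m} (P Q : Fin m → Bool) → (∀ i → P i ≡ true → Q i ≡ true) → count P ≤ count Q
count-mono P Q h = sum-mono-≤ (λ i → fromBool-mono (h i))

fromBool-split : ∀ a b → fromBool a ≡ fromBool (a ∧ b) + fromBool (a ∧ not b)
fromBool-split true true = refl
fromBool-split true false = refl
fromBool-split false b = refl

count-split : ∀ {m} (P Q : Fin m → Bool) → count P ≡ count (λ i → P i ∧ Q i) + count (λ i → P i ∧ not (Q i))
count-split P Q = trans (sum-cong-≗ (λ i → fromBool-split (P i) (Q i))) (∑-distrib-+ (λ i → fromBool (P i ∧ Q i)) (λ i → fromBool (P i ∧ not (Q i))))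

fromBool-∨ : ∀ a b → fromBool (a ∨ b) ≤ fromBool a + fromBool b
fromBool-∨ true b = s≤s z≤n
fromBool-∨ false b = ≤-refl

count-∨ : ∀ {m} (P Q : Fin m → Bool) → count (λ i → P i ∨ Q i) ≤ count P + count Q
count-∨ P Q = ≤-trans (sum-mono-≤ (λ i → fromBool-∨ (P i) (Q i))) (≤-reflexive (∑-distrib-+ (λ i → fromBool (P i)) (λ i → fromBool (Q i))))

count-single : ∀ {m} (a : Fin m) → count (λ i → eqb i a) ≡ 1
count-single a = trans (sum-cong-≗ h) (sum-δ a 1)
  where
  h : ∀ i → fromBool (eqb i a) ≡ δ a i 1
  h i with i ≟ a
  ... | yes _ = refl
  ... | no _ = refl

count-zero : ∀ {m} (P : Fin m → Bool) → (∀ i → P i ≡ false) → count P ≡ 0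
count-zero {m} P h = trans (sum-cong-≗ (λ i → cong fromBool (h i))) (sum-replicate-zero m)

find : ∀ {m} (P : Fin m → Bool) → (Σ (Fin m) λ i → P i ≡ true) ⊎ (∀ i → P i ≡ false)
find {zero} P = inj₂ (λ ())
find {suc m} P with true⊎false (P zero)
... | inj₁ h = inj₁ (zero , h)
... | inj₂ h0 with find (λ i → P (suc i))
...   | inj₁ (i , h) = inj₁ (suc i , h)
...   | inj₂ h = inj₂ (λ { zero → h0 ; (suc i) → h i })

count-pos : ∀ {m} (P : Fin m → Bool) → 1 ≤ count P → Σ (Fin m) λ i → P i ≡ true
count-pos P h with find P
... | inj₁ r = r
... | inj₂ r = ⊥-elim (1+n≰n (≤-trans h (≤-reflexive (count-zero P r))))

inV : ∀ {m k} → Vec (Fin m) k → Fin m → Bool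
inV [] x = false
inV (a ∷ as) x = eqb x a ∨ inV as x

count-inV : ∀ {m k} (xs : Vec (Fin m) k) → count (inV xs) ≤ k
count-inV {m} [] = ≤-reflexive (count-zero {m} (inV []) (λ i → refl))
count-inV (a ∷ as) = ≤-trans (count-∨ (λ x → eqb x a) (inV as)) (≤-reflexive-+ (count-single a) (count-inV as))
  where
  ≤-reflexive-+ : ∀ {x y z} → x ≡ 1 → y ≤ z → x + y ≤ suc z
  ≤-reflexive-+ refl h = s≤s h

inV-i : ∀ {m k} (xs : Vec (Fin m) k) (j : Fin k) → inV xs (lookup xs j) ≡ true
inV-i (a ∷ as) zero = ∨-introˡ (eqb-refl a)
inV-i (a ∷ as) (suc j) = ∨-introʳ (inV-i as j)

fresh : ∀ {m k} (P : Fin m → Bool) → suc k ≤ count P → (xs : Vec (Fin m) k) →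
       Σ (Fin m) λ x → P x ≡ true × (∀ j → lookup xs j ≢ x)
fresh {k = k} P h xs with find (λ x → P x ∧ not (inV xs x))
... | inj₁ (x , e) = x , ∧-conicalˡ _ _ e , (λ j q → true≢false (subst (λ y → inV xs y ≡ true) q (inV-i xs j)) (not-elim (∧-conicalʳ (P x) _ e)))
... | inj₂ r = ⊥-elim (1+n≰n (≤-trans h (≤-trans c1 (count-inV xs))))
  where
  c1 : count P ≤ count (inV xs)
  c1 = count-mono P (inV xs) g
    where
    g : ∀ i → P i ≡ true → inV xs i ≡ true
    g i pi with true⊎false (inV xs i)
    ... | inj₁ q = q
    ... | inj₂ q = ⊥-elim (true≢false (∧-intro pi (not-intro q)) (r i))

count-le : ∀ {m k} (P : Fin m → Bool) (xs : Vec (Fin m) k) → (∀ x → P x ≡ true → inV xs x ≡ true) → count P ≤ k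
count-le P xs h = ≤-trans (count-mono P (inV xs) h) (count-inV xs)

count⇒injection : ∀ {m} (P : Fin m → Bool) k → k ≤ count P →
       Σ (Fin k → Fin m) λ f → Injective _≡_ _≡_ f × (∀ i → P (f i) ≡ true)
count⇒injection P zero h = (λ ()) , (λ {x} → ⊥-elim (noFin0 x)) , (λ ())
  where
  noFin0 : Fin 0 → ⊥
  noFin0 ()
count⇒injection {m} P (suc k) h with count⇒injection P k (≤-trans (n≤1+n k) h)
... | f , finj , fP with fresh P h (Vec.tabulate f)
...   | x , Px , xnew = g , ginj , gP
  where
  fnew : ∀ j → f j ≢ x
  fnew j q = xnew j (trans (lookup∘tabulate f j) q)
  g : Fin (suc k) → Fin m
  g zero = x
  g (suc j) = f j
  ginj : Injective _≡_ _≡_ g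
  ginj {zero} {zero} e = refl
  ginj {zero} {suc j} e = ⊥-elim (fnew j (sym e))
  ginj {suc i} {zero} e = ⊥-elim (fnew i e)
  ginj {suc i} {suc j} e = cong suc (finj e)
  gP : ∀ i → P (g i) ≡ true
  gP zero = Px
  gP (suc j) = fP j

count-point : ∀ {m} (P : Fin m → Bool) (a : Fin m) → P a ≡ true →
              count P ≡ suc (count (λ i → P i ∧ not (eqb i a)))
count-point P a Pa = trans (count-split P (λ i → eqb i a)) (cong (_+ count (λ i → P i ∧ not (eqb i a))) c1)
  where
  c1 : count (λ i → P i ∧ eqb i a) ≡ 1
  c1 = trans (count-ext _ _ h) (count-single a)
    where
    h : ∀ i → (P i ∧ eqb i a) ≡ eqb i a
    h i with i ≟ a
    ... | yes refl rewrite Pa = refl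
    ... | no _ with P i
    ...   | true = refl
    ...   | false = refl

pick≢₁ : ∀ {m} (P : Fin m → Bool) → 2 ≤ count P → ∀ a → Σ (Fin m) λ x → P x ≡ true × a ≢ x
pick≢₁ P h a with fresh P h (a ∷ [])
... | x , px , ne = x , px , ne zero

pick≢₂ : ∀ {m} (P : Fin m → Bool) → 3 ≤ count P → ∀ a b → Σ (Fin m) λ x → P x ≡ true × a ≢ x × b ≢ x
pick≢₂ P h a b with fresh P h (a ∷ b ∷ [])
... | x , px , ne = x , px , ne zero , ne (suc zero)

pick≢₃ : ∀ {m} (P : Fin m → Bool) → 4 ≤ count P → ∀ a b c → Σ (Fin m) λ x → P x ≡ true × a ≢ x × b ≢ x × c ≢ x
pick≢₃ P h a b c with fresh P h (a ∷ b ∷ c ∷ [])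
... | x , px , ne = x , px , ne zero , ne (suc zero) , ne (suc (suc zero))

count≤1 : ∀ {m} (P : Fin m → Bool) a → (∀ x → P x ≡ true → x ≡ a) → count P ≤ 1
count≤1 P a h = count-le P (a ∷ []) (λ x px → ∨-introˡ (≡⇒eqb (h x px)))

count≤2 : ∀ {m} (P : Fin m → Bool) a b → (∀ x → P x ≡ true → x ≡ a ⊎ x ≡ b) → count P ≤ 2
count≤2 P a b h = count-le P (a ∷ b ∷ []) g
  where
  g : ∀ x → P x ≡ true → inV (a ∷ b ∷ []) x ≡ true
  g x px with h x px
  ... | inj₁ e = ∨-introˡ (≡⇒eqb e)
  ... | inj₂ e = ∨-introʳ {eqb x a} (∨-introˡ (≡⇒eqb e))

count≥2 : ∀ {m} (P : Fin m → Bool) {a b} → P a ≡ true → P b ≡ true → a ≢ b → 2 ≤ count P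
count≥2 P {a} {b} Pa Pb ab rewrite count-point P a Pa = s≤s (count-pos-inv _ b (∧-intro Pb (not-intro (≢⇒eqb-false (λ q → ab (sym q))))))
  where
  count-pos-inv : ∀ {m} (Q : Fin m → Bool) x → Q x ≡ true → 1 ≤ count Q
  count-pos-inv Q x Qx rewrite count-point Q x Qx = s≤s z≤n

count≥3 : ∀ {m} (P : Fin m → Bool) {a b c} → P a ≡ true → P b ≡ true → P c ≡ true → a ≢ b → a ≢ c → b ≢ c → 3 ≤ count P
count≥3 P {a} {b} {c} Pa Pb Pc ab ac bc rewrite count-point P a Pa =
  s≤s (count≥2 _ (∧-intro Pb (not-intro (≢⇒eqb-false (λ q → ab (sym q))))) (∧-intro Pc (not-intro (≢⇒eqb-false (λ q → ac (sym q))))) bc)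

count≥4 : ∀ {m} (P : Fin m → Bool) {a b c d} → P a ≡ true → P b ≡ true → P c ≡ true → P d ≡ true →
       a ≢ b → a ≢ c → a ≢ d → b ≢ c → b ≢ d → c ≢ d → 4 ≤ count P
count≥4 P {a} {b} {c} {d} Pa Pb Pc Pd ab ac ad bc bd cd rewrite count-point P a Pa =
  s≤s (count≥3 _ (∧-intro Pb (not-intro (≢⇒eqb-false (λ q → ab (sym q))))) (∧-intro Pc (not-intro (≢⇒eqb-false (λ q → ac (sym q)))))
      (∧-intro Pd (not-intro (≢⇒eqb-false (λ q → ad (sym q))))) bc bd cd)

record TwoElements {m} (P : Fin m → Bool) : Set where
  field
    a b : Fin m
    Pa : P a ≡ true
    Pb : P b ≡ true
    a≢b : a ≢ b
    only : ∀ x → P x ≡ true → (x ≡ a) ⊎ (x ≡ b)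

count≡2⇒two-elements : ∀ {m} (P : Fin m → Bool) → count P ≡ 2 → TwoElements P
count≡2⇒two-elements P c2 with count-pos P (≤-trans (s≤s z≤n) (≤-reflexive (sym c2)))
... | a , Pa with pick≢₁ P (≤-reflexive (sym c2)) a
...   | b , Pb , ab = record { a = a ; b = b ; Pa = Pa ; Pb = Pb ; a≢b = ab ; only = only }
  where
  only : ∀ x → P x ≡ true → (x ≡ a) ⊎ (x ≡ b)
  only x Px with ≡⊎≢ x a | ≡⊎≢ x b
  ... | inj₁ e | _ = inj₁ e
  ... | inj₂ _ | inj₁ e = inj₂ e
  ... | inj₂ xa | inj₂ xb = ⊥-elim (1+n≰n (≤-trans (count≥3 P Pa Pb Px ab (≢-sym xa) (≢-sym xb)) (≤-reflexive c2)))

record ThreeElements {m} (P : Fin m → Bool) : Set where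
  field
    a b c : Fin m
    Pa : P a ≡ true
    Pb : P b ≡ true
    Pc : P c ≡ true
    a≢b : a ≢ b
    a≢c : a ≢ c
    b≢c : b ≢ c
    only : ∀ x → P x ≡ true → (x ≡ a) ⊎ (x ≡ b) ⊎ (x ≡ c)

count≡3⇒three-elements : ∀ {m} (P : Fin m → Bool) → count P ≡ 3 → ThreeElements P
count≡3⇒three-elements P c3 with count-pos P (≤-trans (s≤s z≤n) (≤-reflexive (sym c3)))
... | a , Pa with pick≢₁ P (≤-trans (s≤s (s≤s z≤n)) (≤-reflexive (sym c3))) a
...   | b , Pb , ab with pick≢₂ P (≤-reflexive (sym c3)) a b
...     | c , Pc , ac , bc = record { a = a ; b = b ; c = c ; Pa = Pa ; Pb = Pb ; Pc = Pc ; a≢b = ab ; a≢c = ac ; b≢c = bc ; only = only }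
  where
  only : ∀ x → P x ≡ true → (x ≡ a) ⊎ (x ≡ b) ⊎ (x ≡ c)
  only x Px with ≡⊎≢ x a | ≡⊎≢ x b | ≡⊎≢ x c
  ... | inj₁ e | _ | _ = inj₁ e
  ... | inj₂ _ | inj₁ e | _ = inj₂ (inj₁ e)
  ... | inj₂ _ | inj₂ _ | inj₁ e = inj₂ (inj₂ e)
  ... | inj₂ xa | inj₂ xb | inj₂ xc = ⊥-elim (1+n≰n (≤-trans (count≥4 P Pa Pb Pc Px ab ac (≢-sym xa) bc (≢-sym xb) (≢-sym xc)) (≤-reflexive c3)))

except : ∀ {m} (a : Fin m) (f : Fin m → ℕ) → Fin m → ℕ
except a f w = if eqb w a then 0 else f w

except-≢ : ∀ {m} {a w : Fin m} (f : Fin m → ℕ) → w ≢ a → except a f w ≡ f w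
except-≢ {a = a} {w} f ne with w ≟ a
... | yes p = ⊥-elim (ne p)
... | no _ = refl

count-except₁ : ∀ {m} (P : Fin m → Bool) (a : Fin m) → P a ≡ true → sum (except a (λ w → fromBool (P w))) + 1 ≡ count P
count-except₁ P a Pa = trans (cong (_+ 1) (sum-cong-≗ pw)) (trans (+-comm _ 1) (sym (count-point P a Pa)))
  where
  pw : ∀ w → except a (λ w → fromBool (P w)) w ≡ fromBool (P w ∧ not (eqb w a))
  pw w with eqb w a | P w
  ... | true | true = refl
  ... | true | false = refl
  ... | false | true = refl
  ... | false | false = refl

count-except₂ : ∀ {m} (P : Fin m → Bool) (a b : Fin m) → P a ≡ true → P b ≡ true → a ≢ b →
       sum (except a (except b (λ w → fromBool (P w)))) + 2 ≡ count P
count-except₂ P a b Pa Pb ab = trans (cong (_+ 2) e1) (trans (+-comm _ 2) (trans (cong suc (sym (count-point P' a P'a))) (sym (count-point P b Pb))))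
  where
  P' : _ → Bool
  P' w = P w ∧ not (eqb w b)
  P'a : P' a ≡ true
  P'a rewrite Pa = cong not (≢⇒eqb-false ab)
  e1 : sum (except a (except b (λ w → fromBool (P w)))) ≡ count (λ w → P' w ∧ not (eqb w a))
  e1 = sum-cong-≗ pw
    where
    pw : ∀ w → except a (except b (λ w → fromBool (P w))) w ≡ fromBool (P' w ∧ not (eqb w a))
    pw w with eqb w a | eqb w b | P w
    ... | true | true | true = refl
    ... | true | true | false = refl
    ... | true | false | true = refl
    ... | true | false | false = refl
    ... | false | true | true = refl
    ... | false | true | false = refl
    ... | false | false | true = refl
    ... | false | false | false = refl

choose2 : ℕ → ℕ
choose2 zero = 0
choose2 (suc k) = k + choose2 k

2*choose2 : ∀ k → 2 * choose2 k ≡ k * (k ∸ 1)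
2*choose2 zero = refl
2*choose2 (suc zero) = refl
2*choose2 (suc (suc k)) = begin
  2 * (suc k + choose2 (suc k)) ≡⟨ *-distribˡ-+ 2 (suc k) (choose2 (suc k)) ⟩
  2 * suc k + 2 * choose2 (suc k) ≡⟨ cong (2 * suc k +_) (2*choose2 (suc k)) ⟩
  2 * suc k + suc k * k ≡⟨ solve 1 (λ k → con 2 :* (con 1 :+ k) :+ (con 1 :+ k) :* k := (con 2 :+ k) :* (con 1 :+ k)) refl k ⟩
  suc (suc k) * suc k ∎
  where
  open ≡-Reasoning

choose2-mono-≤ : ∀ {a b} → a ≤ b → choose2 a ≤ choose2 b
choose2-mono-≤ {zero} {b} h = z≤n
choose2-mono-≤ {suc a} {suc b} (s≤s h) = +-mono-≤ h (choose2-mono-≤ h)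

choose2-suc∸choose2 : ∀ a → choose2 (suc a) ∸ choose2 a ≡ a
choose2-suc∸choose2 a = m+n∸n≡m a (choose2 a)

choose2≤1 : ∀ a → a ≤ 2 → choose2 a ≤ 1
choose2≤1 zero h = z≤n
choose2≤1 (suc zero) h = z≤n
choose2≤1 (suc (suc zero)) h = s≤s z≤n
choose2≤1 (suc (suc (suc a))) (s≤s (s≤s ()))

choose2≡0 : ∀ a → a ≤ 1 → choose2 a ≡ 0
choose2≡0 zero h = refl
choose2≡0 (suc zero) h = refl
choose2≡0 (suc (suc a)) (s≤s ())

atLeast2 : ℕ → Bool
atLeast2 (suc (suc _)) = true
atLeast2 _ = false

atLeast2⇒2≤ : ∀ k → atLeast2 k ≡ true → 2 ≤ k
atLeast2⇒2≤ (suc (suc k)) h = s≤s (s≤s z≤n)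

¬atLeast2⇒≤1 : ∀ k → atLeast2 k ≡ false → k ≤ 1
¬atLeast2⇒≤1 zero h = z≤n
¬atLeast2⇒≤1 (suc zero) h = s≤s z≤n

positive : ℕ → Bool
positive zero = false
positive (suc _) = true

-- Consequences of the forbidden subgraphs

module GraphFacts (G : Graph) where
  V : Set
  V = Fin (n G)

  _~_ : V → V → Set
  x ~ y = adj G x y ≡ true

  ~sym : ∀ {x y} → x ~ y → y ~ x
  ~sym {x} {y} h = trans (sym (Graph.sym G x y)) h

  ~ne : ∀ {x y} → x ~ y → x ≢ y
  ~ne {x} h refl = true≢false h (irrefl G x)

  ¬hexagon : ¬ Contains C6 G → ∀ {v p1 p2 p3 p4 p5} → v ~ p1 → p1 ~ p2 → p2 ~ p3 → p3 ~ p4 → p4 ~ p5 → p5 ~ v →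
          v ≢ p2 → v ≢ p3 → v ≢ p4 → p1 ≢ p3 → p1 ≢ p4 → p1 ≢ p5 → p2 ≢ p4 → p2 ≢ p5 → p3 ≢ p5 → ⊥
  ¬hexagon noC6 {v} {p1} {p2} {p3} {p4} {p5} v1 e12 e23 e34 e45 v5 n02 n03 n04 n13 n14 n15 n24 n25 n35 =
    noC6 (f , (λ {i} {j} → lookup-injective distinct i j) , ed)
    where
    f : Fin 6 → V
    f = lookup (v ∷ p1 ∷ p2 ∷ p3 ∷ p4 ∷ p5 ∷ [])
    distinct : Unique (v ∷ p1 ∷ p2 ∷ p3 ∷ p4 ∷ p5 ∷ [])
    distinct = (~ne v1 ∷ n02 ∷ n03 ∷ n04 ∷ ≢-sym (~ne v5) ∷ [])
             ∷ (~ne e12 ∷ n13 ∷ n14 ∷ n15 ∷ [])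
             ∷ (~ne e23 ∷ n24 ∷ n25 ∷ [])
             ∷ (~ne e34 ∷ n35 ∷ [])
             ∷ (~ne e45 ∷ [])
             ∷ [] ∷ []
    ed : ∀ i j → C6 i j ≡ true → adj G (f i) (f j) ≡ true
    ed zero zero ()
    ed zero (suc zero) h = v1
    ed zero (suc (suc zero)) ()
    ed zero (suc (suc (suc zero))) ()
    ed zero (suc (suc (suc (suc zero)))) ()
    ed zero (suc (suc (suc (suc (suc zero))))) h = ~sym v5
    ed (suc zero) zero h = ~sym v1
    ed (suc zero) (suc zero) ()
    ed (suc zero) (suc (suc zero)) h = e12
    ed (suc zero) (suc (suc (suc zero))) ()
    ed (suc zero) (suc (suc (suc (suc zero)))) ()
    ed (suc zero) (suc (suc (suc (suc (suc zero))))) ()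
    ed (suc (suc zero)) zero ()
    ed (suc (suc zero)) (suc zero) h = ~sym e12
    ed (suc (suc zero)) (suc (suc zero)) ()
    ed (suc (suc zero)) (suc (suc (suc zero))) h = e23
    ed (suc (suc zero)) (suc (suc (suc (suc zero)))) ()
    ed (suc (suc zero)) (suc (suc (suc (suc (suc zero))))) ()
    ed (suc (suc (suc zero))) zero ()
    ed (suc (suc (suc zero))) (suc zero) ()
    ed (suc (suc (suc zero))) (suc (suc zero)) h = ~sym e23
    ed (suc (suc (suc zero))) (suc (suc (suc zero))) ()
    ed (suc (suc (suc zero))) (suc (suc (suc (suc zero)))) h = e34
    ed (suc (suc (suc zero))) (suc (suc (suc (suc (suc zero))))) ()
    ed (suc (suc (suc (suc zero)))) zero ()
    ed (suc (suc (suc (suc zero)))) (suc zero) ()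
    ed (suc (suc (suc (suc zero)))) (suc (suc zero)) ()
    ed (suc (suc (suc (suc zero)))) (suc (suc (suc zero))) h = ~sym e34
    ed (suc (suc (suc (suc zero)))) (suc (suc (suc (suc zero)))) ()
    ed (suc (suc (suc (suc zero)))) (suc (suc (suc (suc (suc zero))))) h = e45
    ed (suc (suc (suc (suc (suc zero))))) zero h = v5
    ed (suc (suc (suc (suc (suc zero))))) (suc zero) ()
    ed (suc (suc (suc (suc (suc zero))))) (suc (suc zero)) ()
    ed (suc (suc (suc (suc (suc zero))))) (suc (suc (suc zero))) ()
    ed (suc (suc (suc (suc (suc zero))))) (suc (suc (suc (suc zero)))) h = ~sym e45
    ed (suc (suc (suc (suc (suc zero))))) (suc (suc (suc (suc (suc zero))))) ()

  clique⇒K5 : ∀ {a b c d e} → a ~ b → a ~ c → a ~ d → a ~ e → b ~ c → b ~ d → b ~ e → c ~ d → c ~ e → d ~ e → Contains (K 5) G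
  clique⇒K5 {a} {b} {c} {d} {e} k01 k02 k03 k04 k12 k13 k14 k23 k24 k34 = f , (λ {i} {j} → lookup-injective distinct i j) , ed5
    where
    f : Fin 5 → V
    f = lookup (a ∷ b ∷ c ∷ d ∷ e ∷ [])
    distinct : Unique (a ∷ b ∷ c ∷ d ∷ e ∷ [])
    distinct = (~ne k01 ∷ ~ne k02 ∷ ~ne k03 ∷ ~ne k04 ∷ [])
             ∷ (~ne k12 ∷ ~ne k13 ∷ ~ne k14 ∷ [])
             ∷ (~ne k23 ∷ ~ne k24 ∷ [])
             ∷ (~ne k34 ∷ [])
             ∷ [] ∷ []
    ed5 : ∀ i j → K 5 i j ≡ true → adj G (f i) (f j) ≡ true
    ed5 zero zero ()
    ed5 zero (suc zero) h = k01
    ed5 zero (suc (suc zero)) h = k02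
    ed5 zero (suc (suc (suc zero))) h = k03
    ed5 zero (suc (suc (suc (suc zero)))) h = k04
    ed5 (suc zero) zero h = (~sym k01)
    ed5 (suc zero) (suc zero) ()
    ed5 (suc zero) (suc (suc zero)) h = k12
    ed5 (suc zero) (suc (suc (suc zero))) h = k13
    ed5 (suc zero) (suc (suc (suc (suc zero)))) h = k14
    ed5 (suc (suc zero)) zero h = (~sym k02)
    ed5 (suc (suc zero)) (suc zero) h = (~sym k12)
    ed5 (suc (suc zero)) (suc (suc zero)) ()
    ed5 (suc (suc zero)) (suc (suc (suc zero))) h = k23
    ed5 (suc (suc zero)) (suc (suc (suc (suc zero)))) h = k24
    ed5 (suc (suc (suc zero))) zero h = (~sym k03)
    ed5 (suc (suc (suc zero))) (suc zero) h = (~sym k13)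
    ed5 (suc (suc (suc zero))) (suc (suc zero)) h = (~sym k23)
    ed5 (suc (suc (suc zero))) (suc (suc (suc zero))) ()
    ed5 (suc (suc (suc zero))) (suc (suc (suc (suc zero)))) h = k34
    ed5 (suc (suc (suc (suc zero)))) zero h = (~sym k04)
    ed5 (suc (suc (suc (suc zero)))) (suc zero) h = (~sym k14)
    ed5 (suc (suc (suc (suc zero)))) (suc (suc zero)) h = (~sym k24)
    ed5 (suc (suc (suc (suc zero)))) (suc (suc (suc zero))) h = (~sym k34)
    ed5 (suc (suc (suc (suc zero)))) (suc (suc (suc (suc zero)))) ()

  codegree≤ : ∀ (s : ℕ) → ¬ Contains (K2 (s + 1)) G → ∀ {a b} → a ≢ b → count (λ w → adj G a w ∧ adj G b w) ≤ s
  codegree≤ s noK2 {a} {b} a≢b with s <? count (λ w → adj G a w ∧ adj G b w)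
  ... | no h = ≮⇒≥ h
  ... | yes h with count⇒injection (λ w → adj G a w ∧ adj G b w) (s + 1) (subst (_≤ count (λ w → adj G a w ∧ adj G b w)) (+-comm 1 s) h)
  ...   | f , finj , fP = ⊥-elim (noK2 (g , ginj , ged))
    where
    g : Fin (2 + (s + 1)) → V
    g zero = a
    g (suc zero) = b
    g (suc (suc i)) = f i
    fa : ∀ i → a ~ f i
    fa i = ∧-conicalˡ _ _ (fP i)
    fb : ∀ i → b ~ f i
    fb i = ∧-conicalʳ (adj G a (f i)) _ (fP i)
    ginj : Injective _≡_ _≡_ g
    ginj {zero} {zero} q = refl
    ginj {zero} {suc zero} q = ⊥-elim (a≢b q)
    ginj {zero} {suc (suc j)} q = ⊥-elim (~ne (fa j) q)
    ginj {suc zero} {zero} q = ⊥-elim (a≢b (sym q))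
    ginj {suc zero} {suc zero} q = refl
    ginj {suc zero} {suc (suc j)} q = ⊥-elim (~ne (fb j) q)
    ginj {suc (suc i)} {zero} q = ⊥-elim (~ne (fa i) (sym q))
    ginj {suc (suc i)} {suc zero} q = ⊥-elim (~ne (fb i) (sym q))
    ginj {suc (suc i)} {suc (suc j)} q = cong (λ x → suc (suc x)) (finj q)
    ged : ∀ i j → K2 (s + 1) i j ≡ true → adj G (g i) (g j) ≡ true
    ged zero zero ()
    ged zero (suc zero) ()
    ged zero (suc (suc j)) h = fa j
    ged (suc zero) zero ()
    ged (suc zero) (suc zero) ()
    ged (suc zero) (suc (suc j)) h = fb j
    ged (suc (suc i)) zero h = ~sym (fa i)
    ged (suc (suc i)) (suc zero) h = ~sym (fb i)
    ged (suc (suc i)) (suc (suc j)) ()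

-- Four-cycles through v

length-filter-∷ : ∀ {A : Set} (p : A → Bool) x xs → length (filterᵇ p (x ∷ xs)) ≡ fromBool (p x) + length (filterᵇ p xs)
length-filter-∷ p x xs with p x
... | true = refl
... | false = refl

length-filter-++ : ∀ {A : Set} (p : A → Bool) xs ys → length (filterᵇ p (xs ++ ys)) ≡ length (filterᵇ p xs) + length (filterᵇ p ys)
length-filter-++ p [] ys = refl
length-filter-++ p (x ∷ xs) ys = trans (length-filter-∷ p x (xs ++ ys)) (trans (cong (fromBool (p x) +_) (length-filter-++ p xs ys))
  (trans (sym (+-assoc (fromBool (p x)) _ _)) (cong (_+ length (filterᵇ p ys)) (sym (length-filter-∷ p x xs)))))

length-filter-tabulate : ∀ {A : Set} {m} (p : A → Bool) (f : Fin m → A) → length (filterᵇ p (tabulate f)) ≡ sum (λ i → fromBool (p (f i)))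
length-filter-tabulate {m = zero} p f = refl
length-filter-tabulate {m = suc m} p f = trans (length-filter-∷ p (f zero) _) (cong (fromBool (p (f zero)) +_) (length-filter-tabulate p (λ i → f (suc i))))

length-filter-concatMap : ∀ {A B : Set} {m} (p : B → Bool) (h : A → List B) (f : Fin m → A) →
  length (filterᵇ p (concatMap h (tabulate f))) ≡ sum (λ i → length (filterᵇ p (h (f i))))
length-filter-concatMap {m = zero} p h f = refl
length-filter-concatMap {m = suc m} p h f = trans (length-filter-++ p (h (f zero)) _)
    (cong (length (filterᵇ p (h (f zero))) +_) (length-filter-concatMap p h (λ i → f (suc i))))

length-filter-map : ∀ {A B : Set} {m} (p : B → Bool) (g : A → B) (f : Fin m → A) →
  length (filterᵇ p (map g (tabulate f))) ≡ sum (λ i → fromBool (p (g (f i))))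
length-filter-map {m = zero} p g f = refl
length-filter-map {m = suc m} p g f = trans (length-filter-∷ p (g (f zero)) _) (cong (fromBool (p (g (f zero))) +_) (length-filter-map p g (λ i → f (suc i))))

degree-count : ∀ (G : Graph) v → degree G v ≡ count (adj G v)
degree-count G v = length-filter-tabulate (adj G v) (λ i → i)

quads-count : ∀ m (p : Fin m × Fin m × Fin m × Fin m → Bool) →
  length (filterᵇ p (quads m)) ≡ sum (λ a → sum (λ b → sum (λ c → sum (λ d → fromBool (p (a , b , c , d))))))
quads-count m p =
  trans (length-filter-concatMap p h1 (λ i → i)) (sum-cong-≗ (λ a →
  trans (length-filter-concatMap p (h2 a) (λ i → i)) (sum-cong-≗ (λ b →
  trans (length-filter-concatMap p (h3 a b) (λ i → i)) (sum-cong-≗ (λ c →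
  length-filter-map p (λ d → (a , b , c , d)) (λ i → i)))))))
  where
  h3 : Fin m → Fin m → Fin m → List (Fin m × Fin m × Fin m × Fin m)
  h3 a b c = map (λ d → (a , b , c , d)) (allFin m)
  h2 : Fin m → Fin m → List (Fin m × Fin m × Fin m × Fin m)
  h2 a b = concatMap (h3 a b) (allFin m)
  h1 : Fin m → List (Fin m × Fin m × Fin m × Fin m)
  h1 a = concatMap (h2 a) (allFin m)

sum⁴ : ∀ {m} → (Fin m → Fin m → Fin m → Fin m → ℕ) → ℕ
sum⁴ F = sum (λ a → sum (λ b → sum (λ c → sum (λ d → F a b c d))))

sum⁴-mono-≤ : ∀ {m} (F H : Fin m → Fin m → Fin m → Fin m → ℕ) → (∀ a b c d → F a b c d ≤ H a b c d) → sum⁴ F ≤ sum⁴ H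
sum⁴-mono-≤ F H h = sum-mono-≤ (λ a → sum-mono-≤ (λ b → sum-mono-≤ (λ c → sum-mono-≤ (λ d → h a b c d))))

sum⁴-distrib-+ : ∀ {m} (F H : Fin m → Fin m → Fin m → Fin m → ℕ) → sum⁴ (λ a b c d → F a b c d + H a b c d) ≡ sum⁴ F + sum⁴ H
sum⁴-distrib-+ F H = trans (sum-cong-≗ (λ a → trans (sum-cong-≗ (λ b → trans (sum-cong-≗ (λ c → ∑-distrib-+ (F a b c) (H a b c)))
   (∑-distrib-+ (λ c → sum (F a b c)) (λ c → sum (H a b c))))) (∑-distrib-+ (λ b → sum (λ c → sum (F a b c))) (λ b → sum (λ c → sum (H a b c))))))
   (∑-distrib-+ (λ a → sum (λ b → sum (λ c → sum (F a b c)))) (λ a → sum (λ b → sum (λ c → sum (H a b c)))))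

sum-select : ∀ {m} (v : Fin m) (f : Fin m → ℕ) → sum (λ a → fromBool (eqb a v) * f a) ≡ f v
sum-select v f = trans (sum-cong-≗ h) (sum-δ v (f v))
  where
  h : ∀ a → fromBool (eqb a v) * f a ≡ δ v a (f v)
  h a with a ≟ v
  ... | yes refl = +-identityʳ (f a)
  ... | no _ = refl

∧-elim⁶ : ∀ p q r t y z → p ∧ q ∧ r ∧ t ∧ y ∧ z ≡ true →
          p ≡ true × q ≡ true × r ≡ true × t ≡ true × y ≡ true × z ≡ true
∧-elim⁶ true true true true true true refl = refl , refl , refl , refl , refl , refl

distinct⇒ac-bd : ∀ x1 x2 x3 x4 x5 x6 → not (x1 ∨ x2 ∨ x3 ∨ x4 ∨ x5 ∨ x6) ≡ true → x2 ≡ false × x5 ≡ false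
distinct⇒ac-bd false false x3 x4 false x6 h = refl , refl
distinct⇒ac-bd true x2 x3 x4 x5 x6 ()
distinct⇒ac-bd false true x3 x4 x5 x6 ()
distinct⇒ac-bd false false true x4 x5 x6 ()
distinct⇒ac-bd false false false true x5 x6 ()
distinct⇒ac-bd false false false false true x6 ()

any-of-four : ∀ x1 x2 x3 x4 → x1 ∨ x2 ∨ x3 ∨ x4 ≡ true → (x1 ≡ true) ⊎ (x2 ≡ true) ⊎ (x3 ≡ true) ⊎ (x4 ≡ true)
any-of-four true x2 x3 x4 h = inj₁ refl
any-of-four false true x3 x4 h = inj₂ (inj₁ refl)
any-of-four false false true x4 h = inj₂ (inj₂ (inj₁ refl))
any-of-four false false false true h = inj₂ (inj₂ (inj₂ refl))

module FourCycles (G : Graph) (v : Fin (n G)) where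
  open GraphFacts G using (~sym)

  m : ℕ
  m = n G
  common : Fin m → Fin m → Bool
  common c x = adj G v x ∧ adj G c x
  cherry : Fin m → Fin m → Fin m → Bool
  cherry c b d = common c b ∧ (common c d ∧ (not (eqb b d) ∧ not (eqb c v)))
  isC4 : Fin m → Fin m → Fin m → Fin m → Bool
  isC4 a b c d = isC4Through G v (a , b , c , d)

  cherry-intro : ∀ {c b d} → adj G v b ≡ true → adj G c b ≡ true → adj G v d ≡ true → adj G c d ≡ true → b ≢ d → c ≢ v → cherry c b d ≡ true
  cherry-intro h1 h2 h3 h4 h5 h6 = ∧-intro (∧-intro h1 h2) (∧-intro (∧-intro h3 h4) (∧-intro (not-intro (≢⇒eqb-false h5)) (not-intro (≢⇒eqb-false h6))))

  C4-facts : ∀ a b c d → isC4 a b c d ≡ true →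
    (adj G a b ≡ true) × (adj G b c ≡ true) × (adj G c d ≡ true) × (adj G d a ≡ true) × (a ≢ c) × (b ≢ d) ×
    ((v ≡ a) ⊎ (v ≡ b) ⊎ (v ≡ c) ⊎ (v ≡ d))
  C4-facts a b c d h
    with ∧-elim⁶ (not (eqb a b ∨ eqb a c ∨ eqb a d ∨ eqb b c ∨ eqb b d ∨ eqb c d))
                 (adj G a b) (adj G b c) (adj G c d) (adj G d a) (eqb v a ∨ eqb v b ∨ eqb v c ∨ eqb v d) h
  ... | distinct , ab , bc , cd , da , v∈abcd
    with distinct⇒ac-bd (eqb a b) (eqb a c) (eqb a d) (eqb b c) (eqb b d) (eqb c d) distinct
  ...   | a≁c , b≁d = ab , bc , cd , da , eqb-false⇒≢ a≁c , eqb-false⇒≢ b≁d , v-on-cycle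
    where
    v-on-cycle : (v ≡ a) ⊎ (v ≡ b) ⊎ (v ≡ c) ⊎ (v ≡ d)
    v-on-cycle with any-of-four (eqb v a) (eqb v b) (eqb v c) (eqb v d) v∈abcd
    ... | inj₁ e = inj₁ (eqb⇒≡ e)
    ... | inj₂ (inj₁ e) = inj₂ (inj₁ (eqb⇒≡ e))
    ... | inj₂ (inj₂ (inj₁ e)) = inj₂ (inj₂ (inj₁ (eqb⇒≡ e)))
    ... | inj₂ (inj₂ (inj₂ e)) = inj₂ (inj₂ (inj₂ (eqb⇒≡ e)))

  cherry-terms : Fin m → Fin m → Fin m → Fin m → ℕ
  cherry-terms a b c d = fromBool (eqb a v) * fromBool (cherry c b d) + fromBool (eqb b v) * fromBool (cherry d c a) + fromBool (eqb c v) *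
      fromBool (cherry a d b) + fromBool (eqb d v) * fromBool (cherry b a c)

  1≤true*true : ∀ {x y} → x ≡ true → y ≡ true → 1 ≤ fromBool x * fromBool y
  1≤true*true refl refl = s≤s z≤n

  isC4≤cherry-terms : ∀ a b c d → fromBool (isC4 a b c d) ≤ cherry-terms a b c d
  isC4≤cherry-terms a b c d with true⊎false (isC4 a b c d)
  ... | inj₂ e rewrite e = z≤n
  ... | inj₁ e rewrite e with C4-facts a b c d e
  ...   | ab , bc , cd , da , a≢c , b≢d , inj₁ refl =
          ≤-trans (1≤true*true (eqb-refl v) (cherry-intro ab (~sym bc) (~sym da) cd b≢d (λ q → a≢c (sym q))))
              (≤-trans (m≤m+n _ _) (≤-trans (m≤m+n _ _) (m≤m+n _ _)))
  ...   | ab , bc , cd , da , a≢c , b≢d , inj₂ (inj₁ refl) =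
          ≤-trans (1≤true*true (eqb-refl v) (cherry-intro bc (~sym cd) (~sym ab) da (λ q → a≢c (sym q)) (λ q → b≢d (sym q))))
            (≤-trans (m≤n+m _ (fromBool (eqb a v) * fromBool (cherry c b d))) (≤-trans (m≤m+n _ _) (m≤m+n _ _)))
  ...   | ab , bc , cd , da , a≢c , b≢d , inj₂ (inj₂ (inj₁ refl)) =
          ≤-trans (1≤true*true (eqb-refl v) (cherry-intro cd (~sym da) (~sym bc) ab (λ q → b≢d (sym q)) a≢c))
            (≤-trans (m≤n+m _ (fromBool (eqb a v) * fromBool (cherry c b d) + fromBool (eqb b v) * fromBool (cherry d c a))) (m≤m+n _ _))
  ...   | ab , bc , cd , da , a≢c , b≢d , inj₂ (inj₂ (inj₂ refl)) =
          ≤-trans (1≤true*true (eqb-refl v) (cherry-intro da (~sym ab) (~sym cd) bc a≢c b≢d))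
            (m≤n+m _ (fromBool (eqb a v) * fromBool (cherry c b d) + fromBool (eqb b v) * fromBool (cherry d c a) + fromBool (eqb c v) *
                fromBool (cherry a d b)))

  sum³ : (Fin m → Fin m → Fin m → ℕ) → ℕ
  sum³ F = sum (λ x → sum (λ y → sum (λ z → F x y z)))

  cherries : ℕ
  cherries = sum³ (λ c b d → fromBool (cherry c b d))

  sum-*ˡ : ∀ k (F : Fin m → ℕ) → sum (λ d → k * F d) ≡ k * sum F
  sum-*ˡ k F = sym (*-distribˡ-sum k F)
  sum²-*ˡ : ∀ k (F : Fin m → Fin m → ℕ) → sum (λ c → sum (λ d → k * F c d)) ≡ k * sum (λ c → sum (F c))
  sum²-*ˡ k F = trans (sum-cong-≗ (λ c → sum-*ˡ k (F c))) (sum-*ˡ k (λ c → sum (F c)))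
  sum³-*ˡ : ∀ k (F : Fin m → Fin m → Fin m → ℕ) → sum (λ b → sum (λ c → sum (λ d → k * F b c d))) ≡ k * sum³ F
  sum³-*ˡ k F = trans (sum-cong-≗ (λ b → sum²-*ˡ k (F b))) (sum-*ˡ k (λ b → sum (λ c → sum (F b c))))

  sum³-swap₁₂ : ∀ (F : Fin m → Fin m → Fin m → ℕ) → sum³ F ≡ sum³ (λ y x z → F x y z)
  sum³-swap₁₂ F = ∑-comm (λ x y → sum (F x y))
  sum³-swap₂₃ : ∀ (F : Fin m → Fin m → Fin m → ℕ) → sum³ F ≡ sum³ (λ x z y → F x y z)
  sum³-swap₂₃ F = sum-cong-≗ (λ x → ∑-comm (F x))

  v-first : sum⁴ (λ a b c d → fromBool (eqb a v) * fromBool (cherry c b d)) ≡ cherries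
  v-first = trans (sum-cong-≗ (λ a → sum³-*ˡ (fromBool (eqb a v)) (λ b c d → fromBool (cherry c b d))))
        (trans (sum-select v (λ _ → sum³ (λ b c d → fromBool (cherry c b d)))) (sum³-swap₁₂ (λ b c d → fromBool (cherry c b d))))

  v-second : sum⁴ (λ a b c d → fromBool (eqb b v) * fromBool (cherry d c a)) ≡ cherries
  v-second = trans (sum-cong-≗ (λ a → trans (sum-cong-≗ (λ b → sum²-*ˡ (fromBool (eqb b v)) (λ c d → fromBool (cherry d c a))))
                 (sum-select v (λ _ → sum (λ c → sum (λ d → fromBool (cherry d c a)))))))
       (trans (sum³-swap₂₃ (λ a c d → fromBool (cherry d c a)))
       (trans (sum³-swap₁₂ (λ a d c → fromBool (cherry d c a)))
       (sum³-swap₂₃ (λ d a c → fromBool (cherry d c a)))))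

  v-third : sum⁴ (λ a b c d → fromBool (eqb c v) * fromBool (cherry a d b)) ≡ cherries
  v-third = trans (sum-cong-≗ (λ a → sum-cong-≗ (λ b → trans (sum-cong-≗ (λ c → sum-*ˡ (fromBool (eqb c v)) (λ d → fromBool (cherry a d b))))
                 (sum-select v (λ _ → sum (λ d → fromBool (cherry a d b)))))))
       (sum³-swap₂₃ (λ a b d → fromBool (cherry a d b)))

  v-fourth : sum⁴ (λ a b c d → fromBool (eqb d v) * fromBool (cherry b a c)) ≡ cherries
  v-fourth = trans (sum-cong-≗ (λ a → sum-cong-≗ (λ b → sum-cong-≗ (λ c → sum-select v (λ _ → fromBool (cherry b a c))))))
       (sum³-swap₁₂ (λ a b c → fromBool (cherry b a c)))

  labelled-C4s : ℕ
  labelled-C4s = sum⁴ (λ a b c d → fromBool (isC4 a b c d))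

  labelled-C4s≤4*cherries : labelled-C4s ≤ 4 * cherries
  labelled-C4s≤4*cherries = ≤-trans (sum⁴-mono-≤ _ _ isC4≤cherry-terms) (≤-reflexive eq)
    where
    t1 t2 t3 t4 : Fin m → Fin m → Fin m → Fin m → ℕ
    t1 = λ a b c d → fromBool (eqb a v) * fromBool (cherry c b d)
    t2 = λ a b c d → fromBool (eqb b v) * fromBool (cherry d c a)
    t3 = λ a b c d → fromBool (eqb c v) * fromBool (cherry a d b)
    t4 = λ a b c d → fromBool (eqb d v) * fromBool (cherry b a c)
    eq : sum⁴ cherry-terms ≡ 4 * cherries
    eq = begin
      sum⁴ cherry-terms ≡⟨ sum⁴-distrib-+ (λ a b c d → t1 a b c d + t2 a b c d + t3 a b c d) t4 ⟩
      sum⁴ (λ a b c d → t1 a b c d + t2 a b c d + t3 a b c d) + sum⁴ t4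
        ≡⟨ cong (_+ sum⁴ t4) (sum⁴-distrib-+ (λ a b c d → t1 a b c d + t2 a b c d) t3) ⟩
      sum⁴ (λ a b c d → t1 a b c d + t2 a b c d) + sum⁴ t3 + sum⁴ t4
        ≡⟨ cong (λ x → x + sum⁴ t3 + sum⁴ t4) (sum⁴-distrib-+ t1 t2) ⟩
      sum⁴ t1 + sum⁴ t2 + sum⁴ t3 + sum⁴ t4 ≡⟨ cong₂ _+_ (cong₂ _+_ (cong₂ _+_ v-first v-second) v-third) v-fourth ⟩
      cherries + cherries + cherries + cherries ≡⟨ solve 1 (λ z → z :+ z :+ z :+ z := con 4 :* z) refl cherries ⟩
      4 * cherries ∎
      where
      open ≡-Reasoning

  Φ0 : ℕ
  Φ0 = sum (λ c → if eqb c v then 0 else choose2 (count (common c)))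

  fromBool-∧ : ∀ x w → fromBool (x ∧ w) ≡ fromBool x * fromBool w
  fromBool-∧ true w = sym (+-identityʳ (fromBool w))
  fromBool-∧ false w = refl

  and-false : ∀ x y z → (x ∧ (y ∧ (z ∧ false))) ≡ false
  and-false true true true = refl
  and-false true true false = refl
  and-false true false z = refl
  and-false false y z = refl

  cherries-at : ∀ c b → eqb c v ≡ false → sum (λ d → fromBool (cherry c b d)) ≡ fromBool (common c b) * (count (common c) ∸ 1)
  cherries-at c b cv = trans (sum-cong-≗ pw) (trans (sum-*ˡ (fromBool (common c b)) (λ d → fromBool (common c d ∧ not (eqb d b))))
      (e2 (true⊎false (common c b))))
    where
    pw : ∀ d → fromBool (cherry c b d) ≡ fromBool (common c b) * fromBool (common c d ∧ not (eqb d b))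
    pw d rewrite cv | eqb-comm b d = trans (fromBool-∧ (common c b) _) (cong (λ t → fromBool (common c b) * fromBool t) (lem (common c d) (not (eqb d b))))
      where
      lem : ∀ x y → (x ∧ (y ∧ true)) ≡ (x ∧ y)
      lem x true = refl
      lem x false = refl
    e2 : (common c b ≡ true) ⊎ (common c b ≡ false) → fromBool (common c b) * count (λ d → common c d ∧ not (eqb d b)) ≡ fromBool (common c b) *
        (count (common c) ∸ 1)
    e2 (inj₁ t) = cong (fromBool (common c b) *_) (sym (cong (_∸ 1) (count-point (common c) b t)))
    e2 (inj₂ f) rewrite f = refl

  cherries-through : ∀ c → sum (λ b → sum (λ d → fromBool (cherry c b d))) ≡ 2 * (if eqb c v then 0 else choose2 (count (common c)))
  cherries-through c with true⊎false (eqb c v)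
  ... | inj₁ t = trans (trans (sum-cong-≗
          (λ b → trans (sum-cong-≗ (λ d → cong fromBool
              (trans (cong (λ q → common c b ∧ (common c d ∧ (not (eqb b d) ∧ not q))) t)
              (and-false (common c b) (common c d) (not (eqb b d)))))) (sum-replicate-zero m))) (sum-replicate-zero m))
              (cong (λ q → 2 * (if q then 0 else choose2 (count (common c)))) (sym t))
  ... | inj₂ f = trans (sum-cong-≗ (λ b → cherries-at c b f))
          (trans (sum-cong-≗ (λ b → *-comm (fromBool (common c b)) _))
          (trans (sum-*ˡ (count (common c) ∸ 1) (λ b → fromBool (common c b)))
          (trans (*-comm _ (count (common c))) (trans (sym (2*choose2 (count (common c))))
              (cong (λ t → 2 * (if t then 0 else choose2 (count (common c)))) (sym f))))))

  cherries≡2*Φ0 : cherries ≡ 2 * Φ0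
  cherries≡2*Φ0 = trans (sum-cong-≗ cherries-through) (sym (*-distribˡ-sum 2 (λ c → if eqb c v then 0 else choose2 (count (common c)))))

  -- Each labelled 4-cycle through v yields, for the position v occupies, a cherry (c, b, d):
  -- c is v's antipode and b ≠ d its neighbours on the cycle. There are 2Φ0 ordered cherries
  -- and 4 positions, while c4Count divides by the 8 labellings of a cycle.
  c4Count≤Φ0 : c4Count G v ≤ Φ0
  c4Count≤Φ0 = ≤-trans (≤-reflexive (cong (_/ 8) (quads-count m (isC4Through G v))))
           (≤-trans (/-monoˡ-≤ 8 q) (≤-reflexive (m*n/n≡m Φ0 8)))
    where
    q : labelled-C4s ≤ Φ0 * 8
    q = ≤-trans labelled-C4s≤4*cherries (≤-reflexive (trans (cong (4 *_) cherries≡2*Φ0) (trans (sym (*-assoc 4 2 Φ0)) (*-comm 8 Φ0))))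

-- The potential and the induction on |X|

module Potential (G : Graph) (v : Fin (n G)) (s : ℕ) (noK2 : ¬ Contains (K2 (s + 1)) G) (noC6 : ¬ Contains C6 G)
           (X : Fin (n G) → Bool) (hX : ∀ x → X x ≡ true → adj G v x ≡ true) where
  open GraphFacts G public
  m : ℕ
  m = n G

  N : V → Set
  N x = adj G v x ≡ true

  X⇒N : ∀ {x} → X x ≡ true → N x
  X⇒N {x} h = hX x h

  X⇒v≢ : ∀ {x} → X x ≡ true → v ≢ x
  X⇒v≢ h = ~ne (X⇒N h)

  X≢¬X : ∀ {x y} → X x ≡ true → X y ≡ false → x ≢ y
  X≢¬X hx hy refl = true≢false hx hy

  ¬hexagon-via-v : ∀ {u1 u2 y x1 x2} → u1 ≢ v → u2 ≢ v → N x1 → N y → N x2 → u1 ~ x1 → u1 ~ y → u2 ~ y → u2 ~ x2 →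
        u1 ≢ u2 → x1 ≢ y → x2 ≢ y → x1 ≢ x2 → x1 ≢ u2 → x2 ≢ u1 → ⊥
  ¬hexagon-via-v u1v u2v nx1 ny nx2 a1 a2 a3 a4 d12 dx1y dx2y dx12 dx1u2 dx2u1 =
    ¬hexagon noC6 nx1 (~sym a1) a2 (~sym a3) a4 (~sym nx2) (λ q → u1v (sym q)) (~ne ny) (λ q → u2v (sym q))
      dx1y dx1u2 dx12 d12 (λ q → dx2u1 (sym q)) (λ q → dx2y (sym q))

  ¬hexagon-in-N : ∀ {p1 p2 p3 p4 p5} → N p1 → p1 ~ p2 → p2 ~ p3 → p3 ~ p4 → p4 ~ p5 → N p5 →
          v ≢ p2 → v ≢ p3 → v ≢ p4 → p1 ≢ p3 → p1 ≢ p4 → p1 ≢ p5 → p2 ≢ p4 → p2 ≢ p5 → p3 ≢ p5 → ⊥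
  ¬hexagon-in-N n1 e1 e2 e3 e4 n5 = ¬hexagon noC6 n1 e1 e2 e3 e4 (~sym n5)

  codegree≤s : ∀ {a b} → a ≢ b → count (λ w → adj G a w ∧ adj G b w) ≤ s
  codegree≤s = codegree≤ s noK2

  kX : V → ℕ
  kX w = count (λ x → X x ∧ adj G w x)

  kX≤s : ∀ {w} → w ≢ v → kX w ≤ s
  kX≤s {w} wv = ≤-trans (count-mono _ _ g) (codegree≤s (λ q → wv (sym q)))
    where
    g : ∀ x → (X x ∧ adj G w x) ≡ true → (adj G v x ∧ adj G w x) ≡ true
    g x h = ∧-intro (X⇒N (∧-conicalˡ _ _ h)) (∧-conicalʳ (X x) _ h)

  Φ : ℕ
  Φ = sum (λ w → if eqb w v then 0 else choose2 (kX w))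

  Φ≡0 : (∀ w → (not (eqb w v) ∧ atLeast2 (kX w)) ≡ false) → Φ ≡ 0
  Φ≡0 sparse = trans (sum-cong-≗ vanish) (sum-replicate-zero m)
    where
    vanish : ∀ w → (if eqb w v then 0 else choose2 (kX w)) ≡ 0
    vanish w with true⊎false (eqb w v)
    ... | inj₁ e rewrite e = refl
    ... | inj₂ e rewrite e = choose2≡0 (kX w) (¬atLeast2⇒≤1 (kX w) (trans (cong (λ q → not q ∧ atLeast2 (kX w)) (sym e)) (sparse w)))

  module Removal (T : V → Bool) where
    X' : V → Bool
    X' x = X x ∧ not (T x)
    kX' : V → ℕ
    kX' w = count (λ x → X' x ∧ adj G w x)
    tw : V → ℕ
    tw w = count (λ x → (X x ∧ adj G w x) ∧ T x)
    drop : V → ℕ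
    drop w = choose2 (kX w) ∸ choose2 (kX' w)

    ksplit : ∀ w → kX w ≡ tw w + kX' w
    ksplit w = trans (count-split (λ x → X x ∧ adj G w x) T) (cong (tw w +_) (count-ext _ _ g))
      where
      g : ∀ x → ((X x ∧ adj G w x) ∧ not (T x)) ≡ ((X x ∧ not (T x)) ∧ adj G w x)
      g x with X x | adj G w x | T x
      ... | true | true | true = refl
      ... | true | true | false = refl
      ... | true | false | true = refl
      ... | true | false | false = refl
      ... | false | _ | _ = refl

    drop≤choose2 : ∀ w → drop w ≤ choose2 (kX w)
    drop≤choose2 w = m∸n≤m (choose2 (kX w)) (choose2 (kX' w))

    drop≡0 : ∀ w → kX w ≤ 1 → drop w ≡ 0
    drop≡0 w h = n≤0⇒n≡0 (≤-trans (drop≤choose2 w) (≤-reflexive (choose2≡0 _ h)))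

    drop≤1 : ∀ w → kX w ≤ 2 → drop w ≤ 1
    drop≤1 w h = ≤-trans (drop≤choose2 w) (choose2≤1 _ h)

    drop-untouched : ∀ w → tw w ≡ 0 → drop w ≡ 0
    drop-untouched w h rewrite ksplit w | h = n∸n≡0 (choose2 (kX' w))

    drop≤k∸1 : ∀ w → tw w ≤ 1 → drop w ≤ kX w ∸ 1
    drop≤k∸1 w h with tw w | ksplit w
    ... | zero | e rewrite e = subst (_≤ (kX' w ∸ 1)) (sym (n∸n≡0 (choose2 (kX' w)))) z≤n
    ... | suc zero | e rewrite e = ≤-reflexive (choose2-suc∸choose2 (kX' w))
    ... | suc (suc _) | e = ⊥-elim (1+n≰n (≤-trans (s≤s (s≤s z≤n)) h))

    drop-cases : ∀ w → (drop w ≡ 0) ⊎ ((Σ V λ y → X y ≡ true × adj G w y ≡ true × T y ≡ true) × (2 ≤ kX w))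
    drop-cases w with find (λ x → (X x ∧ adj G w x) ∧ T x)
    ... | inj₂ none = inj₁ (drop-untouched w (count-zero _ none))
    ... | inj₁ (y , hy) with 2 ≤? kX w
    ...   | no k1 = inj₁ (drop≡0 w (≤-pred (≰⇒> k1)))
    ...   | yes k2 = inj₂ ((y , ∧-conicalˡ _ _ (∧-conicalˡ _ _ hy) , ∧-conicalʳ (X y) _ (∧-conicalˡ _ _ hy) , ∧-conicalʳ (X y ∧ adj G w y) _ hy) , k2)

    count-split-T : count X ≡ count (λ x → X x ∧ T x) + count X'
    count-split-T = count-split X T

    Φ' : ℕ
    Φ' = sum (λ w → if eqb w v then 0 else choose2 (kX' w))

    totalDrop : ℕ
    totalDrop = sum (λ w → if eqb w v then 0 else drop w)

    Φ≤Φ'+totalDrop : Φ ≤ Φ' + totalDrop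
    Φ≤Φ'+totalDrop = ≤-trans (sum-mono-≤ pw) (≤-reflexive (∑-distrib-+ (λ w → if eqb w v then 0 else choose2 (kX' w)) (λ w → if eqb w v then 0 else drop w)))
      where
      pw : ∀ w → (if eqb w v then 0 else choose2 (kX w)) ≤ (if eqb w v then 0 else choose2 (kX' w)) + (if eqb w v then 0 else drop w)
      pw w with eqb w v
      ... | true = z≤n
      ... | false = m≤n+m∸n (choose2 (kX w)) (choose2 (kX' w))

    totalDrop≤ : (g : V → ℕ) → (∀ w → w ≢ v → drop w ≤ g w) → totalDrop ≤ sum g
    totalDrop≤ g h = sum-mono-≤ pw
      where
      pw : ∀ w → (if eqb w v then 0 else drop w) ≤ g w
      pw w with ≡⊎≢ w v
      ... | inj₁ refl rewrite eqb-refl v = z≤n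
      ... | inj₂ ne rewrite ≢⇒eqb-false ne = h w ne

module Induction (G : Graph) (v : Fin (n G)) (s : ℕ) (noK2 : ¬ Contains (K2 (s + 1)) G) (noC6 : ¬ Contains C6 G) (M : ℕ) where
  Sub : (Fin (n G) → Bool) → Set
  Sub X = ∀ x → X x ≡ true → adj G v x ≡ true

  -- Deleting X ∩ T lowers Φ by at most D, and 2(s+1)D ≤ M|X ∩ T| pays for that, so the
  -- invariant 2(s+1)Φ(X) ≤ M|X| passes from X ∖ T back to X.
  record GoodRemoval (X : Fin (n G) → Bool) (hX : Sub X) : Set where
    field
      T : Fin (n G) → Bool
      Tne : 1 ≤ count (λ x → X x ∧ T x)
      D : ℕ
      drops : Potential.Removal.totalDrop G v s noK2 noC6 X hX T ≤ D
      arith : 2 * (s + 1) * D ≤ M * count (λ x → X x ∧ T x)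

  GoodRemovals : Set
  GoodRemovals = ∀ X (hX : Sub X) w0 → w0 ≢ v → 2 ≤ Potential.kX G v s noK2 noC6 X hX w0 → GoodRemoval X hX

  module _ (goodRemovals : GoodRemovals) where
    -- f is fuel bounding |X|, needed only for termination.
    potential-bound : ∀ f X (hX : Sub X) → count X ≤ f → 2 * (s + 1) * Potential.Φ G v s noK2 noC6 X hX ≤ M * count X
    potential-bound f X hX cX≤f with find (λ w → not (eqb w v) ∧ atLeast2 (Potential.kX G v s noK2 noC6 X hX w))
    ... | inj₂ sparse = subst (_≤ M * count X) (sym (trans (cong (2 * (s + 1) *_) (Φ≡0 sparse)) (*-zeroʳ (2 * (s + 1))))) z≤n
      where open Potential G v s noK2 noC6 X hX
    ... | inj₁ (w0 , h0) with goodRemovals X hX w0 (λ q → true≢false (∧-conicalˡ _ _ h0) (cong not (≡⇒eqb q)))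
        (atLeast2⇒2≤ _ (∧-conicalʳ (not (eqb w0 v)) _ h0))
    ...   | st with f
    ...     | zero = ⊥-elim (1+n≰n (≤-trans (GoodRemoval.Tne st) (≤-trans (count-mono _ X (λ x q → ∧-conicalˡ _ _ q)) cX≤f)))
    ...     | suc f = begin
      c * Φ                                    ≤⟨ *-monoʳ-≤ c (≤-trans Φ≤Φ'+totalDrop (+-monoʳ-≤ Φ' drops)) ⟩
      c * (Φ' + D)                             ≡⟨ *-distribˡ-+ c Φ' D ⟩
      c * Φ' + c * D                           ≤⟨ +-mono-≤ IH arith ⟩
      M * count X' + M * count (λ x → X x ∧ T x)  ≡⟨ sym (*-distribˡ-+ M (count X') _) ⟩
      M * (count X' + count (λ x → X x ∧ T x))    ≡⟨ cong (M *_) (trans (+-comm (count X') _) (sym count-split-T)) ⟩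
      M * count X                              ∎
      where
      open ≤-Reasoning
      open Potential G v s noK2 noC6 X hX
      open GoodRemoval st
      open Removal T
      c : ℕ
      c = 2 * (s + 1)
      cX'≤f : count X' ≤ f
      cX'≤f = ≤-pred (≤-trans (+-monoˡ-≤ (count X') Tne) (≤-trans (≤-reflexive (sym count-split-T)) cX≤f))
      IH : c * Φ' ≤ M * count X'
      IH = potential-bound f X' (λ x q → hX x (∧-conicalˡ _ _ q)) cX'≤f

-- The budgets of the removal steps

≤⇒∃+ : ∀ {a b} → a ≤ b → Σ ℕ λ j → b ≡ a + j
≤⇒∃+ {zero} {b} h = b , refl
≤⇒∃+ {suc a} {suc b} (s≤s h) with ≤⇒∃+ h
... | j , e = j , cong suc e

+≡⇒≤ : ∀ {x y} (r : ℕ) → x + r ≡ y → x ≤ y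
+≡⇒≤ {x} r e = subst (x ≤_) e (m≤m+n x r)

budget-u∉X-k≥4 : ∀ s k M → 2 ≤ k → k ≤ s → (s ∸ 1) * (s + 2) ≤ M → 2 * (s + 1) * choose2 k ≤ M * k
budget-u∉X-k≥4 s k M k2 ks hM with ≤⇒∃+ k2
... | i , refl with ≤⇒∃+ ks
...   | j , refl = begin
  2 * (s' + 1) * choose2 k' ≡⟨ lem1 ⟩
  (s' + 1) * (2 * choose2 k') ≡⟨ cong ((s' + 1) *_) (2*choose2 k') ⟩
  (s' + 1) * (k' * (1 + i)) ≤⟨ +≡⇒≤ (k' * (1 + 4 * j + j * j + i + i * j))
      (solve 2 (λ i j → ((con 2 :+ i :+ j :+ con 1) :* ((con 2 :+ i) :* (con 1 :+ i))) :+ (con 2 :+ i) :*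
      (con 1 :+ con 4 :* j :+ j :* j :+ i :+ i :* j) := ((con 1 :+ i :+ j) :* (con 2 :+ i :+ j :+ con 2)) :* (con 2 :+ i)) refl i j) ⟩
  (s' ∸ 1) * (s' + 2) * k' ≤⟨ *-monoˡ-≤ k' hM ⟩
  M * k' ∎
  where
  open ≤-Reasoning
  k' s' : ℕ
  k' = 2 + i
  s' = k' + j
  lem1 : 2 * (s' + 1) * choose2 k' ≡ (s' + 1) * (2 * choose2 k')
  lem1 = solve 2 (λ s c → con 2 :* (s :+ con 1) :* c := (s :+ con 1) :* (con 2 :* c)) refl s' (choose2 k')

budget-u∉X-k≡3 : ∀ s M → 4 * (s + 1) ≤ M → 2 * (s + 1) * 6 ≤ M * 3
budget-u∉X-k≡3 s M hM = begin
  2 * (s + 1) * 6 ≡⟨ solve 1 (λ s → con 2 :* (s :+ con 1) :* con 6 := (con 4 :* (s :+ con 1)) :* con 3) refl s ⟩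
  4 * (s + 1) * 3 ≤⟨ *-monoˡ-≤ 3 hM ⟩
  M * 3 ∎
  where open ≤-Reasoning

budget-u∉X-k≡2 : ∀ s M → 2 ≤ s → (s ∸ 1) * (s + 2) ≤ M → 2 * (s + 1) * (1 + (s ∸ 2)) ≤ M * 2
budget-u∉X-k≡2 s M s2 hM with ≤⇒∃+ s2
... | j , refl = begin
  2 * (2 + j + 1) * (1 + j) ≤⟨ +≡⇒≤ (2 * (1 + j))
      (solve 1 (λ j → con 2 :* (con 2 :+ j :+ con 1) :* (con 1 :+ j) :+ con 2 :* (con 1 :+ j) := (con 1 :+ j) :* (con 2 :+ j :+ con 2) :* con 2)
      refl j) ⟩
  (1 + j) * (2 + j + 2) * 2 ≤⟨ *-monoˡ-≤ 2 hM ⟩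
  M * 2 ∎
  where open ≤-Reasoning

budget-u∈X-k≥3 : ∀ s k M → 2 ≤ k → k ≤ s → (s ∸ 1) * (s + 2) ≤ M → 2 * (s + 1) * (choose2 k + (s ∸ 1)) ≤ M * (k + 1)
budget-u∈X-k≥3 s k M k2 ks hM with ≤⇒∃+ k2
... | i , refl with ≤⇒∃+ ks
...   | j , refl = begin
  2 * (s' + 1) * (choose2 k' + (s' ∸ 1)) ≡⟨ lem1 ⟩
  (s' + 1) * (2 * choose2 k' + 2 * (s' ∸ 1)) ≡⟨ cong (λ z → (s' + 1) * (z + 2 * (s' ∸ 1))) (2*choose2 k') ⟩
  (s' + 1) * (k' * (1 + i) + 2 * (1 + i + j)) ≤⟨ +≡⇒≤ (5 * j + j * j + 4 * i * j + i * j * j + i * i * j)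
       (solve 2 (λ i j → (con 2 :+ i :+ j :+ con 1) :* ((con 2 :+ i) :* (con 1 :+ i) :+ con 2 :* (con 1 :+ i :+ j)) :+
           (con 5 :* j :+ j :* j :+ con 4 :* i :* j :+ i :* j :* j :+ i :* i :* j)
          := (con 1 :+ i :+ j) :* (con 2 :+ i :+ j :+ con 2) :* (con 2 :+ i :+ con 1)) refl i j) ⟩
  (s' ∸ 1) * (s' + 2) * (k' + 1) ≤⟨ *-monoˡ-≤ (k' + 1) hM ⟩
  M * (k' + 1) ∎
  where
  open ≤-Reasoning
  k' s' : ℕ
  k' = 2 + i
  s' = k' + j
  lem1 : 2 * (s' + 1) * (choose2 k' + (s' ∸ 1)) ≡ (s' + 1) * (2 * choose2 k' + 2 * (s' ∸ 1))
  lem1 = solve 3 (λ s c t → con 2 :* (s :+ con 1) :* (c :+ t) := (s :+ con 1) :* (con 2 :* c :+ con 2 :* t)) refl s' (choose2 k') (s' ∸ 1)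

budget-u∈X-k≡3-noK5 : ∀ s M → 4 * (s + 1) ≤ M → 2 * (s + 1) * (3 + 5) ≤ M * 4
budget-u∈X-k≡3-noK5 s M hM = begin
  2 * (s + 1) * (3 + 5) ≡⟨ solve 1 (λ s → con 2 :* (s :+ con 1) :* (con 3 :+ con 5) := (con 4 :* (s :+ con 1)) :* con 4) refl s ⟩
  4 * (s + 1) * 4 ≤⟨ *-monoˡ-≤ 4 hM ⟩
  M * 4 ∎
  where open ≤-Reasoning

budget-u∈X-k≡3 : ∀ s M → 6 * (s + 1) ≤ M → 2 * (s + 1) * (3 + 9) ≤ M * 4
budget-u∈X-k≡3 s M hM = begin
  2 * (s + 1) * (3 + 9) ≡⟨ solve 1 (λ s → con 2 :* (s :+ con 1) :* (con 3 :+ con 9) := (con 6 :* (s :+ con 1)) :* con 4) refl s ⟩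
  6 * (s + 1) * 4 ≤⟨ *-monoˡ-≤ 4 hM ⟩
  M * 4 ∎
  where open ≤-Reasoning

budget-u∈X-k≡2 : ∀ s M → 2 ≤ s → 4 * (s + 1) ≤ M → (s ∸ 1) * (s + 2) ≤ M → 2 * (s + 1) * (s + 1) ≤ M * 3
budget-u∈X-k≡2 s M s2 h4 hM with s ≤? 5
... | yes s5 = begin
  2 * (s + 1) * (s + 1) ≤⟨ *-monoʳ-≤ (2 * (s + 1)) (+-monoˡ-≤ 1 s5) ⟩
  2 * (s + 1) * 6 ≡⟨ solve 1 (λ s → con 2 :* (s :+ con 1) :* con 6 := (con 4 :* (s :+ con 1)) :* con 3) refl s ⟩
  4 * (s + 1) * 3 ≤⟨ *-monoˡ-≤ 3 h4 ⟩
  M * 3 ∎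
  where open ≤-Reasoning
... | no s5 with ≤⇒∃+ (≰⇒> s5)
...   | j , refl = begin
  2 * (6 + j + 1) * (6 + j + 1) ≤⟨ +≡⇒≤ (22 + 11 * j + j * j)
      (solve 1 (λ j → con 2 :* (con 6 :+ j :+ con 1) :* (con 6 :+ j :+ con 1) :+ (con 22 :+ con 11 :* j :+ j :* j)
       := (con 5 :+ j) :* (con 6 :+ j :+ con 2) :* con 3) refl j) ⟩
  (6 + j ∸ 1) * (6 + j + 2) * 3 ≤⟨ *-monoˡ-≤ 3 hM ⟩
  M * 3 ∎
  where open ≤-Reasoning

budget-u∈X-k≡2-enlarged : ∀ s M → 2 ≤ s → (s ∸ 1) * (s + 2) ≤ M → 2 * (s + 1) * (1 + (s ∸ 1) + (s ∸ 2)) ≤ M * 4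
budget-u∈X-k≡2-enlarged s M s2 hM with ≤⇒∃+ s2
... | j , refl = begin
  2 * (2 + j + 1) * (1 + (1 + j) + j) ≤⟨ +≡⇒≤ (4 + 4 * j)
      (solve 1 (λ j → con 2 :* (con 2 :+ j :+ con 1) :* (con 1 :+ (con 1 :+ j) :+ j) :+ (con 4 :+ con 4 :* j)
       := (con 1 :+ j) :* (con 2 :+ j :+ con 2) :* con 4) refl j) ⟩
  (1 + j) * (2 + j + 2) * 4 ≤⟨ *-monoˡ-≤ 4 hM ⟩
  M * 4 ∎
  where open ≤-Reasoning

-- Removal steps around the centre u

module Centre (G : Graph) (v : Fin (n G)) (s : ℕ) (noK2 : ¬ Contains (K2 (s + 1)) G) (noC6 : ¬ Contains C6 G)
              (X : Fin (n G) → Bool) (hX : ∀ x → X x ≡ true → adj G v x ≡ true) (u : Fin (n G)) (uv : u ≢ v) where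
  open Potential G v s noK2 noC6 X hX public

  Xᵤ : V → Bool
  Xᵤ x = X x ∧ adj G u x

  k : ℕ
  k = kX u

  ks : k ≤ s
  ks = kX≤s uv

  Xᵤ⇒X : ∀ {x} → Xᵤ x ≡ true → X x ≡ true
  Xᵤ⇒X {x} h = ∧-conicalˡ _ _ h

  Xᵤ⇒adj : ∀ {x} → Xᵤ x ≡ true → u ~ x
  Xᵤ⇒adj {x} h = ∧-conicalʳ (X x) _ h

  Xᵤ⇒≢u : ∀ {x} → Xᵤ x ≡ true → x ≢ u
  Xᵤ⇒≢u h q = ~ne (Xᵤ⇒adj h) (sym q)

  Xᵤ-intro : ∀ {x} → X x ≡ true → u ~ x → Xᵤ x ≡ true
  Xᵤ-intro a b = ∧-intro a b

  Xadj : V → V → Bool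
  Xadj w x = X x ∧ adj G w x

  Xadj⇒X : ∀ {w x} → Xadj w x ≡ true → X x ≡ true
  Xadj⇒X {w} {x} h = ∧-conicalˡ _ _ h

  Xadj⇒adj : ∀ {w x} → Xadj w x ≡ true → w ~ x
  Xadj⇒adj {w} {x} h = ∧-conicalʳ (X x) _ h

  Xadj-intro : ∀ {w x} → X x ≡ true → w ~ x → Xadj w x ≡ true
  Xadj-intro a b = ∧-intro a b

  isβ : V → Bool
  isβ w = not (X w) ∧ adj G u w ∧ not (eqb w v)

  -- α: the X-neighbours of u; β: the neighbours of u outside X; γ: all other vertices.
  αβγ-split : ∀ {R : Set} w → w ≢ v → w ≢ u → (Xᵤ w ≡ true → R) → (X w ≡ false → u ~ w → R) → (Xᵤ w ≡ false → adj G u w ≡ false → R) → R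
  αβγ-split w wv wu fa fb fc with true⊎false (Xᵤ w)
  ... | inj₁ Kw = fa Kw
  ... | inj₂ Kw with true⊎false (adj G u w)
  ...   | inj₂ uw = fc Kw uw
  ...   | inj₁ uw with true⊎false (X w)
  ...     | inj₁ Xw = ⊥-elim (true≢false (Xᵤ-intro Xw uw) Kw)
  ...     | inj₂ Xw = fb Xw uw

  bothAdj : V → V → V → Bool
  bothAdj a b w = adj G a w ∧ adj G b w

  bothAdj-off-uv≤s∸1 : ∀ {a b} → a ≢ b → bothAdj a b v ≡ true → sum (except v (except u (λ w → fromBool (bothAdj a b w)))) ≤ s ∸ 1
  bothAdj-off-uv≤s∸1 {a} {b} ab Pv = ≤-trans (sum-mono-≤ pw)
      (≤-trans (≤-reflexive (sym (m+n∸n≡m _ 1))) (∸-monoˡ-≤ 1 (≤-trans (≤-reflexive (count-except₁ (bothAdj a b) v Pv)) (codegree≤s ab))))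
    where
    pw : ∀ w → except v (except u (λ w → fromBool (bothAdj a b w))) w ≤ except v (λ w → fromBool (bothAdj a b w)) w
    pw w with eqb w v | eqb w u
    ... | true | _ = z≤n
    ... | false | true = z≤n
    ... | false | false = ≤-refl

  bothAdj-off-uv≤s∸2 : ∀ {a b} → a ≢ b → bothAdj a b v ≡ true → bothAdj a b u ≡ true → sum (except v (except u (λ w → fromBool (bothAdj a b w)))) ≤ s ∸ 2
  bothAdj-off-uv≤s∸2 {a} {b} ab Pv Pu = ≤-trans (≤-reflexive (sym (m+n∸n≡m _ 2)))
      (∸-monoˡ-≤ 2 (≤-trans (≤-reflexive (count-except₂ (bothAdj a b) v u Pv Pu (λ q → uv (sym q)))) (codegree≤s ab)))

  kX≤2-by : ∀ w a b → (∀ q → Xadj w q ≡ true → q ≢ a → q ≢ b → ⊥) → kX w ≤ 2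
  kX≤2-by w a b h = count≤2 (Xadj w) a b g
    where
    g : ∀ q → Xadj w q ≡ true → (q ≡ a) ⊎ (q ≡ b)
    g q sq with ≡⊎≢ q a | ≡⊎≢ q b
    ... | inj₁ e | _ = inj₁ e
    ... | inj₂ _ | inj₁ e = inj₂ e
    ... | inj₂ na | inj₂ nb = ⊥-elim (h q sq na nb)

  kX≤1-by : ∀ w a → (∀ q → Xadj w q ≡ true → q ≢ a → ⊥) → kX w ≤ 1
  kX≤1-by w a h = count≤1 (Xadj w) a g
    where
    g : ∀ q → Xadj w q ≡ true → q ≡ a
    g q sq with ≡⊎≢ q a
    ... | inj₁ e = e
    ... | inj₂ na = ⊥-elim (h q sq na)

  another-Xadj : ∀ w a → 2 ≤ kX w → Σ V λ q → Xadj w q ≡ true × q ≢ a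
  another-Xadj w a h with pick≢₁ (Xadj w) h a
  ... | q , sq , aq = q , sq , (λ e → aq (sym e))

module Step-u∈X (G : Graph) (v : Fin (n G)) (s : ℕ) (noK2 : ¬ Contains (K2 (s + 1)) G) (noC6 : ¬ Contains C6 G)
          (X : Fin (n G) → Bool) (hX : ∀ x → X x ≡ true → adj G v x ≡ true)
          (u : Fin (n G)) (uv : u ≢ v) (uX : X u ≡ true) where
  open Centre G v s noK2 noC6 X hX u uv public

  uN : N u
  uN = X⇒N uX

  private-neighbours-agree : ∀ {w1 w2 p1 p2} → w1 ≢ v → w2 ≢ v → w1 ~ u → w2 ~ u → w1 ≢ w2 →
            Xadj w1 p1 ≡ true → p1 ≢ u → Xadj w2 p2 ≡ true → p2 ≢ u → p1 ≢ w2 → p2 ≢ w1 → p1 ≡ p2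
  private-neighbours-agree {w1} {w2} {p1} {p2} w1v w2v w1u w2u w12 s1 p1u s2 p2u p1w2 p2w1 with ≡⊎≢ p1 p2
  ... | inj₁ e = e
  ... | inj₂ ne = ⊥-elim (¬hexagon-via-v w1v w2v (X⇒N (Xadj⇒X s1)) uN (X⇒N (Xadj⇒X s2)) (Xadj⇒adj s1) w1u w2u (Xadj⇒adj s2) w12 p1u p2u ne p1w2 p2w1)

  T : V → Bool
  T x = Xᵤ x ∨ eqb x u

  T-cases : ∀ {x} → T x ≡ true → (Xᵤ x ≡ true) ⊎ (x ≡ u)
  T-cases {x} h with ∨-elim h
  ... | inj₁ e = inj₁ e
  ... | inj₂ e = inj₂ (eqb⇒≡ e)

  |X∩T| : count (λ x → X x ∧ T x) ≡ suc k
  |X∩T| = trans (count-point _ u (∧-intro uX (∨-introʳ {Xᵤ u} (eqb-refl u)))) (cong suc (count-ext _ _ g))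
    where
    g : ∀ x → ((X x ∧ T x) ∧ not (eqb x u)) ≡ Xᵤ x
    g x with ≡⊎≢ x u
    ... | inj₁ refl rewrite eqb-refl u | irrefl G u | uX = refl
    ... | inj₂ ne rewrite ≢⇒eqb-false ne with X x | adj G u x
    ...   | true | true = refl
    ...   | true | false = refl
    ...   | false | _ = refl

  open Removal T public

  γ-drop≡0 : 3 ≤ k → ∀ w → w ≢ v → w ≢ u → Xᵤ w ≡ false → adj G u w ≡ false → drop w ≡ 0
  γ-drop≡0 k3 w wv wu Kw uw with drop-cases w
  ... | inj₁ d0 = d0
  ... | inj₂ ((y , Xy , wy , Ty) , kw2) with T-cases Ty
  ...   | inj₂ refl = ⊥-elim (true≢false (~sym wy) uw)
  ...   | inj₁ Ky with pick≢₁ (Xadj w) kw2 y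
  ...     | x2 , sx2 , yx2 with pick≢₂ Xᵤ k3 y x2
  ...       | x1 , Kx1 , yx1 , x2x1 = ⊥-elim (¬hexagon-via-v uv wv (X⇒N (Xᵤ⇒X Kx1)) (X⇒N Xy) (X⇒N (Xadj⇒X sx2)) (Xᵤ⇒adj Kx1) (Xᵤ⇒adj Ky) wy (Xadj⇒adj sx2)
                (λ q → wu (sym q)) (λ q → yx1 (sym q)) (λ q → yx2 (sym q)) (λ q → x2x1 (sym q))
                (λ q → true≢false (subst (λ z → Xᵤ z ≡ true) q Kx1) Kw) (λ q → true≢false (~sym (subst (λ z → adj G w z ≡ true) q (Xadj⇒adj sx2))) uw))

  drop≤fromBool : ∀ w (P : Bool) → kX w ≤ 2 → (2 ≤ kX w → P ≡ true) → drop w ≤ fromBool P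
  drop≤fromBool w P h1 h2 with 2 ≤? kX w
  ... | yes p rewrite h2 p = drop≤1 w h1
  ... | no p rewrite drop≡0 w (≤-pred (≰⇒> p)) = z≤n

  module K≥3 (k3 : 3 ≤ k) where
    β-¬hexagon : ∀ {w y q} → w ≢ v → X w ≡ false → Xᵤ y ≡ true → w ~ y → Xadj w q ≡ true → q ≢ u → q ≢ y → ⊥
    β-¬hexagon {w} {y} {q} wv Xw Ky wy sq qu qy with pick≢₂ Xᵤ k3 y q
    ... | x1 , Kx1 , yx1 , qx1 = ¬hexagon-via-v uv wv (X⇒N (Xᵤ⇒X Kx1)) (X⇒N (Xᵤ⇒X Ky)) (X⇒N (Xadj⇒X sq)) (Xᵤ⇒adj Kx1) (Xᵤ⇒adj Ky) wy (Xadj⇒adj sq)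
          (X≢¬X uX Xw) (λ e → yx1 (sym e)) qy (λ e → qx1 (sym e)) (X≢¬X (Xᵤ⇒X Kx1) Xw) qu

    β-drop≤kX∸1 : ∀ w → w ≢ v → X w ≡ false → u ~ w → drop w ≤ kX w ∸ 1
    β-drop≤kX∸1 w wv Xw uw with find (λ y → Xᵤ y ∧ adj G w y)
    ... | inj₁ (y , h) = fin (kX w) refl
      where
      Ky : Xᵤ y ≡ true
      Ky = ∧-conicalˡ _ _ h
      wy : w ~ y
      wy = ∧-conicalʳ (Xᵤ y) _ h
      k≤2 : kX w ≤ 2
      k≤2 = kX≤2-by w u y (λ q sq qu qy → β-¬hexagon wv Xw Ky wy sq qu qy)
      fin : ∀ j → kX w ≡ j → drop w ≤ kX w ∸ 1
      fin zero e rewrite drop≡0 w (≤-trans (≤-reflexive e) z≤n) = z≤n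
      fin (suc zero) e rewrite drop≡0 w (≤-reflexive e) = z≤n
      fin (suc (suc zero)) e = subst (λ z → drop w ≤ z ∸ 1) (sym e) (drop≤1 w (≤-reflexive e))
      fin (suc (suc (suc j))) e = ⊥-elim (1+n≰n (≤-trans (s≤s (s≤s (s≤s z≤n))) (≤-trans (≤-reflexive (sym e)) k≤2)))
    ... | inj₂ none = drop≤k∸1 w (count≤1 _ u g)
      where
      g : ∀ x → ((X x ∧ adj G w x) ∧ T x) ≡ true → x ≡ u
      g x h with T-cases {x} (∧-conicalʳ (X x ∧ adj G w x) _ h)
      ... | inj₂ e = e
      ... | inj₁ Kx' = ⊥-elim (true≢false (∧-intro Kx' (∧-conicalʳ (X x) _ (∧-conicalˡ _ _ h))) (none x))

    module Withβ (w0 p0 : V) (w0v : w0 ≢ v) (Xw0 : X w0 ≡ false) (uw0 : u ~ w0) (sp0 : Xadj w0 p0 ≡ true) (p0u : p0 ≢ u) where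
      β-drop≤bothAdj : ∀ w → w ≢ v → X w ≡ false → u ~ w → w ≢ w0 → drop w ≤ fromBool (bothAdj u p0 w)
      β-drop≤bothAdj w wv Xw uw ww0 = drop≤fromBool w _ (kX≤2-by w u p0 (λ q sq qu qp → qp (eqp sq qu))) g
        where
        eqp : ∀ {q} → Xadj w q ≡ true → q ≢ u → q ≡ p0
        eqp sq qu = private-neighbours-agree wv w0v (~sym uw) (~sym uw0) ww0 sq qu sp0 p0u (X≢¬X (Xadj⇒X sq) Xw0) (X≢¬X (Xadj⇒X sp0) Xw)
        g : 2 ≤ kX w → bothAdj u p0 w ≡ true
        g h with another-Xadj w u h
        ... | q , sq , qu = ∧-intro uw (~sym (subst (λ z → w ~ z) (eqp sq qu) (Xadj⇒adj sq)))

      α-kX≤1 : ∀ w → Xᵤ w ≡ true → kX w ≤ 1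
      α-kX≤1 w Kw = kX≤1-by w u h
        where
        wv : w ≢ v
        wv e = X⇒v≢ (Xᵤ⇒X Kw) (sym e)
        h : ∀ q → Xadj w q ≡ true → q ≢ u → ⊥
        h q sq qu with ≡⊎≢ w p0
        ... | inj₁ refl with pick≢₂ Xᵤ k3 w q
        ...   | x1 , Kx1 , wx1 , qx1 = ¬hexagon-in-N (X⇒N (Xadj⇒X sq)) (~sym (Xadj⇒adj sq)) (~sym (Xadj⇒adj sp0)) (~sym uw0) (Xᵤ⇒adj Kx1) (X⇒N (Xᵤ⇒X Kx1))
                   (λ e → X⇒v≢ (Xᵤ⇒X Kw) e) (λ e → w0v (sym e)) (λ e → uv (sym e)) (X≢¬X (Xadj⇒X sq) Xw0) qu qx1
                   (Xᵤ⇒≢u Kw) wx1 (λ e → X≢¬X (Xᵤ⇒X Kx1) Xw0 (sym e))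
        h q sq qu | inj₂ wp0 with ≡⊎≢ q p0
        ...   | inj₁ refl with pick≢₂ Xᵤ k3 w q
        ...     | x1 , Kx1 , wx1 , qx1 = ¬hexagon-in-N (X⇒N (Xᵤ⇒X Kx1)) (~sym (Xᵤ⇒adj Kx1)) uw0 (Xadj⇒adj sp0) (~sym (Xadj⇒adj sq)) (X⇒N (Xᵤ⇒X Kw))
                   (λ e → uv (sym e)) (λ e → w0v (sym e)) (λ e → X⇒v≢ (Xadj⇒X sp0) e) (X≢¬X (Xᵤ⇒X Kx1) Xw0) (λ e → qx1 (sym e)) (λ e → wx1 (sym e))
                   (λ e → p0u (sym e)) (λ e → Xᵤ⇒≢u Kw (sym e)) (λ e → X≢¬X (Xᵤ⇒X Kw) Xw0 (sym e))
        h q sq qu | inj₂ wp0 | inj₂ qp0 = qp0 (private-neighbours-agree wv w0v (~sym (Xᵤ⇒adj Kw)) (~sym uw0) (λ e → X≢¬X (Xᵤ⇒X Kw) Xw0 e) sq qu sp0 p0u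
                   (X≢¬X (Xadj⇒X sq) Xw0) (λ e → wp0 (sym e)))

    α-Xadj-in-Xᵤ : ∀ {w y q} → Xᵤ w ≡ true → Xᵤ y ≡ true → w ~ y → Xadj w q ≡ true → q ≢ u → Xᵤ q ≡ false → ⊥
    α-Xadj-in-Xᵤ {w} {y} {q} Kw Ky wy sq qu Kq with pick≢₂ Xᵤ k3 w y
    ... | x1 , Kx1 , wx1 , yx1 = ¬hexagon-via-v (λ e → X⇒v≢ (Xᵤ⇒X Kw) (sym e)) uv (X⇒N (Xadj⇒X sq)) (X⇒N (Xᵤ⇒X Ky)) (X⇒N (Xᵤ⇒X Kx1))
        (Xadj⇒adj sq) wy (Xᵤ⇒adj Ky) (Xᵤ⇒adj Kx1)
          (Xᵤ⇒≢u Kw) (λ e → true≢false (subst (λ z → Xᵤ z ≡ true) (sym e) Ky) Kq) (λ e → yx1 (sym e))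
              (λ e → true≢false (subst (λ z → Xᵤ z ≡ true) (sym e) Kx1) Kq) qu (λ e → wx1 (sym e))

  α-Xadj-unique : 4 ≤ k → ∀ {w y q} → Xᵤ w ≡ true → Xᵤ y ≡ true → w ~ y → Xadj w q ≡ true → q ≢ u → q ≢ y → ⊥
  α-Xadj-unique k4 {w} {y} {q} Kw Ky wy sq qu qy with pick≢₃ Xᵤ k4 w y q
  ... | x1 , Kx1 , wx1 , yx1 , qx1 = ¬hexagon-via-v (λ e → X⇒v≢ (Xᵤ⇒X Kw) (sym e)) uv (X⇒N (Xadj⇒X sq)) (X⇒N (Xᵤ⇒X Ky)) (X⇒N (Xᵤ⇒X Kx1))
      (Xadj⇒adj sq) wy (Xᵤ⇒adj Ky) (Xᵤ⇒adj Kx1)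
          (Xᵤ⇒≢u Kw) qy (λ e → yx1 (sym e)) qx1 qu (λ e → wx1 (sym e))

module Step-u∉X (G : Graph) (v : Fin (n G)) (s : ℕ) (noK2 : ¬ Contains (K2 (s + 1)) G) (noC6 : ¬ Contains C6 G) (M : ℕ)
          (s2 : 2 ≤ s) (hMs : (s ∸ 1) * (s + 2) ≤ M) (hM4 : 4 * (s + 1) ≤ M)
          (X : Fin (n G) → Bool) (hX : ∀ x → X x ≡ true → adj G v x ≡ true)
          (u : Fin (n G)) (uv : u ≢ v) (uX : X u ≡ false)
          (kmax : ∀ w → w ≢ v → Potential.kX G v s noK2 noC6 X hX w ≤ Potential.kX G v s noK2 noC6 X hX u)
          (pref : ∀ x → X x ≡ true → suc (Potential.kX G v s noK2 noC6 X hX x) ≤ Potential.kX G v s noK2 noC6 X hX u)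
          (k2 : 2 ≤ Potential.kX G v s noK2 noC6 X hX u) where
  open Centre G v s noK2 noC6 X hX u uv
  open Induction G v s noK2 noC6 M using (GoodRemoval)
  open Removal Xᵤ

  |X∩T| : count (λ x → X x ∧ Xᵤ x) ≡ k
  |X∩T| = count-ext _ _ g
    where
    g : ∀ x → (X x ∧ Xᵤ x) ≡ Xᵤ x
    g x with X x
    ... | true = refl
    ... | false = refl

  Xᵤ-Xadj : ∀ {w y x1 x2} → w ≢ v → w ≢ u → X y ≡ true → w ~ y → Xᵤ y ≡ true → X x2 ≡ true → w ~ x2 → x2 ≢ y →
         Xᵤ x1 ≡ true → x1 ≢ y → (x1 ≡ x2) ⊎ (x1 ≡ w)
  Xᵤ-Xadj {w} {y} {x1} {x2} wv wu Xy wy Ky Xx2 wx2 x2y Kx1 x1y with ≡⊎≢ x1 x2 | ≡⊎≢ x1 w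
  ... | inj₁ e | _ = inj₁ e
  ... | inj₂ _ | inj₁ e = inj₂ e
  ... | inj₂ n12 | inj₂ n1w = ⊥-elim (¬hexagon-via-v uv wv (X⇒N (Xᵤ⇒X Kx1)) (X⇒N Xy) (X⇒N Xx2) (Xᵤ⇒adj Kx1) (Xᵤ⇒adj Ky) wy wx2
          (λ q → wu (sym q)) x1y x2y n12 n1w (X≢¬X Xx2 uX))

  module Case-k≥4 (k4 : 4 ≤ k) where
    pw : ∀ w → w ≢ v → drop w ≤ δ u w (choose2 k) + 0
    pw w wv with ≡⊎≢ w u
    ... | inj₁ refl = ≤δ-at 0 (drop≤choose2 u)
    ... | inj₂ wu with drop-cases w
    ...   | inj₁ d0 rewrite d0 = z≤n
    ...   | inj₂ ((y , Xy , wy , Ky) , kw2) with pick≢₁ (Xadj w) kw2 y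
    ...     | x2 , sx2 , yx2 with pick≢₃ Xᵤ k4 y x2 w
    ...       | x1 , Kx1 , yx1 , x2x1 , wx1 with Xᵤ-Xadj wv wu Xy wy Ky (∧-conicalˡ _ _ sx2) (∧-conicalʳ (X x2) _ sx2) (λ q → yx2 (sym q)) Kx1
        (λ q → yx1 (sym q))
    ...         | inj₁ e = ⊥-elim (x2x1 (sym e))
    ...         | inj₂ e = ⊥-elim (wx1 (sym e))

    goodRemoval : GoodRemoval X hX
    goodRemoval = record { T = Xᵤ ; Tne = ≤-trans (≤-trans (s≤s z≤n) k2) (≤-reflexive (sym |X∩T|)) ; D = choose2 k
                 ; drops = ≤-trans (totalDrop≤ _ pw) (≤-reflexive
                     (trans (sum-δ-+ u (choose2 k) (λ _ → 0)) (trans (cong (choose2 k +_) (sum-replicate-zero (n G))) (+-identityʳ _))))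
                 ; arith = subst (λ z → 2 * (s + 1) * choose2 k ≤ M * z) (sym |X∩T|) (budget-u∉X-k≥4 s k M k2 ks hMs) }

  module Case-k≡3 (k3 : k ≡ 3) where
    pw : ∀ w → w ≢ v → drop w ≤ δ u w (choose2 k) + fromBool (Xᵤ w)
    pw w wv with ≡⊎≢ w u
    ... | inj₁ refl = ≤δ-at (fromBool (Xᵤ u)) (drop≤choose2 u)
    ... | inj₂ wu with drop-cases w
    ...   | inj₁ d0 rewrite d0 = z≤n
    ...   | inj₂ ((y , Xy , wy , Ky) , kw2) with pick≢₁ (Xadj w) kw2 y
    ...     | x2 , sx2 , yx2 = ≤δ-off (choose2 k) (fromBool (Xᵤ w)) wu bnd
      where
      k3' : 3 ≤ count Xᵤ
      k3' = ≤-reflexive (sym k3)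
      Kw : Xᵤ w ≡ true
      Kw with pick≢₂ Xᵤ k3' y x2
      ... | x1 , Kx1 , yx1 , x2x1 with Xᵤ-Xadj wv wu Xy wy Ky (∧-conicalˡ _ _ sx2) (∧-conicalʳ (X x2) _ sx2) (λ q → yx2 (sym q)) Kx1 (λ q → yx1 (sym q))
      ...   | inj₁ e = ⊥-elim (x2x1 (sym e))
      ...   | inj₂ e = subst (λ z → Xᵤ z ≡ true) e Kx1
      kX≤2 : kX w ≤ 2
      kX≤2 = count≤2 (Xadj w) y x2 all
        where
        all : ∀ x → Xadj w x ≡ true → (x ≡ y) ⊎ (x ≡ x2)
        all x sx with ≡⊎≢ x y | ≡⊎≢ x x2
        ... | inj₁ e | _ = inj₁ e
        ... | inj₂ _ | inj₁ e = inj₂ e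
        ... | inj₂ xy | inj₂ xx2 with pick≢₂ Xᵤ k3' y w
        ...   | x1 , Kx1 , yx1 , wx1 with Xᵤ-Xadj wv wu Xy wy Ky (∧-conicalˡ _ _ sx2) (∧-conicalʳ (X x2) _ sx2) (λ q → yx2 (sym q)) Kx1 (λ q → yx1 (sym q))
                                        | Xᵤ-Xadj wv wu Xy wy Ky (∧-conicalˡ _ _ sx) (∧-conicalʳ (X x) _ sx) xy Kx1 (λ q → yx1 (sym q))
        ...     | inj₂ e | _ = ⊥-elim (wx1 (sym e))
        ...     | _ | inj₂ e = ⊥-elim (wx1 (sym e))
        ...     | inj₁ e1 | inj₁ e2 = ⊥-elim (xx2 (trans (sym e2) e1))
      bnd : drop w ≤ fromBool (Xᵤ w)
      bnd rewrite Kw = drop≤1 w kX≤2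

    goodRemoval : GoodRemoval X hX
    goodRemoval = record { T = Xᵤ ; Tne = ≤-trans (≤-trans (s≤s z≤n) k2) (≤-reflexive (sym |X∩T|)) ; D = 6
                 ; drops = ≤-trans (totalDrop≤ _ pw) (≤-reflexive (trans (sum-δ-+ u (choose2 k) (λ w → fromBool (Xᵤ w))) (cong (λ z → choose2 z + z) k3)))
                 ; arith = subst (λ z → 2 * (s + 1) * 6 ≤ M * z) (sym (trans |X∩T| k3)) (budget-u∉X-k≡3 s M hM4) }

  module Case-k≡2 (k2e : k ≡ 2) where
    open TwoElements (count≡2⇒two-elements Xᵤ k2e) renaming (Pa to Ka; Pb to Kb; only to allK)

    bothAdj-from-Xᵤ : ∀ {w x1 y} → Xᵤ x1 ≡ true → Xᵤ y ≡ true → x1 ≢ y → w ~ x1 → w ~ y → bothAdj a b w ≡ true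
    bothAdj-from-Xᵤ {w} {x1} {y} K1 Ky ne w1 wy with allK x1 K1 | allK y Ky
    ... | inj₁ refl | inj₁ refl = ⊥-elim (ne refl)
    ... | inj₁ refl | inj₂ refl = ∧-intro (~sym w1) (~sym wy)
    ... | inj₂ refl | inj₁ refl = ∧-intro (~sym wy) (~sym w1)
    ... | inj₂ refl | inj₂ refl = ⊥-elim (ne refl)

    h : V → ℕ
    h = except v (except u (λ w → fromBool (bothAdj a b w)))

    pw : ∀ w → w ≢ v → drop w ≤ δ u w (choose2 k) + h w
    pw w wv with ≡⊎≢ w u
    ... | inj₁ refl = ≤δ-at (h u) (drop≤choose2 u)
    ... | inj₂ wu rewrite except-≢ {a = v} (except u (λ w → fromBool (bothAdj a b w))) wv | except-≢ {a = u} (λ w → fromBool (bothAdj a b w)) wu with drop-cases w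
    ...   | inj₁ d0 rewrite d0 = z≤n
    ...   | inj₂ ((y , Xy , wy , Ky) , kw2) with pick≢₁ (Xadj w) kw2 y | pick≢₁ Xᵤ (≤-reflexive (sym k2e)) y
    ...     | x2 , sx2 , yx2 | x1 , Kx1 , yx1 with Xᵤ-Xadj wv wu Xy wy Ky (∧-conicalˡ _ _ sx2) (∧-conicalʳ (X x2) _ sx2) (λ q → yx2 (sym q)) Kx1
        (λ q → yx1 (sym q))
    ...       | inj₂ e = ⊥-elim (1+n≰n (≤-trans (pref w (subst (λ z → X z ≡ true) e (Xᵤ⇒X Kx1))) (≤-trans (≤-reflexive k2e) kw2)))
    ...       | inj₁ e = ≤δ-off (choose2 k) _ wu bnd
      where
      Pw : bothAdj a b w ≡ true
      Pw = bothAdj-from-Xᵤ Kx1 Ky (λ q → yx1 (sym q)) (subst (λ z → w ~ z) (sym e) (∧-conicalʳ (X x2) _ sx2)) wy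
      bnd : drop w ≤ fromBool (bothAdj a b w)
      bnd rewrite Pw = drop≤1 w (≤-trans (kmax w wv) (≤-reflexive k2e))

    Pv : bothAdj a b v ≡ true
    Pv = ∧-intro (~sym (X⇒N (Xᵤ⇒X Ka))) (~sym (X⇒N (Xᵤ⇒X Kb)))
    Pu : bothAdj a b u ≡ true
    Pu = ∧-intro (~sym (Xᵤ⇒adj Ka)) (~sym (Xᵤ⇒adj Kb))

    sh : sum h ≤ s ∸ 2
    sh = bothAdj-off-uv≤s∸2 a≢b Pv Pu

    goodRemoval : GoodRemoval X hX
    goodRemoval = record { T = Xᵤ ; Tne = ≤-trans (≤-trans (s≤s z≤n) k2) (≤-reflexive (sym |X∩T|)) ; D = 1 + (s ∸ 2)
                 ; drops = ≤-trans (totalDrop≤ _ pw) (≤-trans (≤-reflexive (sum-δ-+ u (choose2 k) h)) (+-mono-≤ (≤-reflexive (cong choose2 k2e)) sh))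
                 ; arith = subst (λ z → 2 * (s + 1) * (1 + (s ∸ 2)) ≤ M * z) (sym (trans |X∩T| k2e)) (budget-u∉X-k≡2 s M s2 hMs) }

  goodRemoval : GoodRemoval X hX
  goodRemoval with k ≟ℕ 2 | k ≟ℕ 3
  ... | yes e | _ = Case-k≡2.goodRemoval e
  ... | no _ | yes e = Case-k≡3.goodRemoval e
  ... | no n2 | no n3 = Case-k≥4.goodRemoval (k≥4 k2 n2 n3)
    where
    k≥4 : ∀ {x} → 2 ≤ x → x ≢ 2 → x ≢ 3 → 4 ≤ x
    k≥4 {suc zero} (s≤s ()) _ _
    k≥4 {suc (suc zero)} _ n2 _ = ⊥-elim (n2 refl)
    k≥4 {suc (suc (suc zero))} _ _ n3 = ⊥-elim (n3 refl)
    k≥4 {suc (suc (suc (suc x)))} _ _ _ = s≤s (s≤s (s≤s (s≤s z≤n)))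

module Step-u∈X-k≥3 (G : Graph) (v : Fin (n G)) (s : ℕ) (noK2 : ¬ Contains (K2 (s + 1)) G) (noC6 : ¬ Contains C6 G) (M : ℕ)
          (hMs : (s ∸ 1) * (s + 2) ≤ M) (hM4 : 4 * (s + 1) ≤ M)
          (X : Fin (n G) → Bool) (hX : ∀ x → X x ≡ true → adj G v x ≡ true)
          (u : Fin (n G)) (uv : u ≢ v) (uX : X u ≡ true)
          (kmax : ∀ w → w ≢ v → Potential.kX G v s noK2 noC6 X hX w ≤ Potential.kX G v s noK2 noC6 X hX u)
          (k2 : 2 ≤ Potential.kX G v s noK2 noC6 X hX u)
          (k3 : 3 ≤ Potential.kX G v s noK2 noC6 X hX u) where
  open Step-u∈X G v s noK2 noC6 X hX u uv uX
  open K≥3 k3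
  open Induction G v s noK2 noC6 M using (GoodRemoval)

  D : ℕ
  D = choose2 k + (s ∸ 1)

  goodRemoval-by : (g : V → ℕ) → (∀ w → w ≢ v → drop w ≤ g w) → sum g ≤ D → GoodRemoval X hX
  goodRemoval-by g pw sg = record { T = T ; Tne = ≤-trans (s≤s z≤n) (≤-reflexive (sym |X∩T|)) ; D = D
     ; drops = ≤-trans (totalDrop≤ g pw) sg
     ; arith = subst (λ z → 2 * (s + 1) * D ≤ M * z) (trans (+-comm k 1) (sym |X∩T|)) (budget-u∈X-k≥3 s k M k2 ks hMs) }

  k-1≤s-1 : ∀ w → w ≢ v → kX w ∸ 1 ≤ s ∸ 1
  k-1≤s-1 w wv = ∸-monoˡ-≤ 1 (kX≤s wv)

  sum-δ² : ∀ (a b : V) (c d : ℕ) → sum (λ w → δ a w c + δ b w d) ≡ c + d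
  sum-δ² a b c d = trans (∑-distrib-+ (λ w → δ a w c) (λ w → δ b w d)) (cong₂ _+_ (sum-δ a c) (sum-δ b d))

  module βWitness (w0 : V) (Bw0 : isβ w0 ∧ atLeast2 (kX w0) ≡ true) where
    Xw0 : X w0 ≡ false
    Xw0 = not-elim (∧-conicalˡ (not (X w0)) _ (∧-conicalˡ (isβ w0) _ Bw0))
    uw0 : u ~ w0
    uw0 = ∧-conicalˡ _ _ (∧-conicalʳ (not (X w0)) _ (∧-conicalˡ (isβ w0) _ Bw0))
    w0v : w0 ≢ v
    w0v e = true≢false (∧-conicalʳ (adj G u w0) _ (∧-conicalʳ (not (X w0)) _ (∧-conicalˡ (isβ w0) _ Bw0))) (cong not (≡⇒eqb e))
    kw0 : 2 ≤ kX w0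
    kw0 = atLeast2⇒2≤ _ (∧-conicalʳ (isβ w0) _ Bw0)
    pp : Σ V λ q → Xadj w0 q ≡ true × q ≢ u
    pp = another-Xadj w0 u kw0
    p0 : V
    p0 = proj₁ pp
    sp0 : Xadj w0 p0 ≡ true
    sp0 = proj₁ (proj₂ pp)
    p0u : p0 ≢ u
    p0u = proj₂ (proj₂ pp)

  module Someβ (w0 : V) (Bw0 : isβ w0 ∧ atLeast2 (kX w0) ≡ true) where
    open βWitness w0 Bw0
    open Withβ w0 p0 w0v Xw0 uw0 sp0 p0u

    α-drop≡0 : ∀ w → Xᵤ w ≡ true → drop w ≡ 0
    α-drop≡0 w Kw = drop≡0 w (α-kX≤1 w Kw)

    goodRemoval : GoodRemoval X hX
    goodRemoval with find (λ w1 → isβ w1 ∧ not (eqb w1 w0) ∧ atLeast2 (kX w1))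
    ... | inj₂ none = goodRemoval-by g pw (≤-reflexive (sum-δ² u w0 (choose2 k) (s ∸ 1)))
      where
      g : V → ℕ
      g w = δ u w (choose2 k) + δ w0 w (s ∸ 1)
      pw : ∀ w → w ≢ v → drop w ≤ g w
      pw w wv with ≡⊎≢ w u
      ... | inj₁ refl = ≤δ-at {u = u} _ (drop≤choose2 u)
      ... | inj₂ wu = ≤δ-off (choose2 k) _ wu (αβγ-split w wv wu fa fb fc)
        where
        fa : Xᵤ w ≡ true → drop w ≤ δ w0 w (s ∸ 1)
        fa Kw rewrite α-drop≡0 w Kw = z≤n
        fc : Xᵤ w ≡ false → adj G u w ≡ false → drop w ≤ δ w0 w (s ∸ 1)
        fc Kw uw rewrite γ-drop≡0 k3 w wv wu Kw uw = z≤n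
        fb : X w ≡ false → u ~ w → drop w ≤ δ w0 w (s ∸ 1)
        fb Xw uw with ≡⊎≢ w w0
        ... | inj₁ refl = ≤-trans (≤δ-at {u = w0} 0 (≤-trans (β-drop≤kX∸1 w0 w0v Xw0 uw0) (k-1≤s-1 w0 w0v))) (≤-reflexive (+-identityʳ _))
        ... | inj₂ ww0 rewrite drop≡0 w (¬atLeast2⇒≤1 (kX w)
            (∧∧-false⇒false (isβ w) (not (eqb w w0)) (atLeast2 (kX w)) (∧-intro (not-intro Xw) (∧-intro uw (not-intro (≢⇒eqb-false wv))))
            (not-intro (≢⇒eqb-false ww0)) (none w))) = z≤n
    ... | inj₁ (w1 , Bw1) = goodRemoval-by g pw sg
      where
      Bw1' : isβ w1 ∧ atLeast2 (kX w1) ≡ true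
      Bw1' = ∧-intro (∧-conicalˡ (isβ w1) _ Bw1) (∧-conicalʳ (not (eqb w1 w0)) _ (∧-conicalʳ (isβ w1) _ Bw1))
      w1w0 : w1 ≢ w0
      w1w0 e = true≢false (∧-conicalˡ _ _ (∧-conicalʳ (isβ w1) _ Bw1)) (cong not (≡⇒eqb e))
      module β₁ = βWitness w1 Bw1'
      p1p0 : β₁.p0 ≡ p0
      p1p0 = private-neighbours-agree β₁.w0v w0v (~sym β₁.uw0) (~sym uw0) w1w0 β₁.sp0 β₁.p0u sp0 p0u (X≢¬X (Xadj⇒X β₁.sp0) Xw0) (X≢¬X (Xadj⇒X sp0) β₁.Xw0)
      h : V → ℕ
      h = except v (except u (λ w → fromBool (bothAdj u p0 w)))
      g : V → ℕ
      g w = δ u w (choose2 k) + h w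
      sg : sum g ≤ D
      sg = ≤-trans (≤-reflexive (sum-δ-+ u (choose2 k) h))
          (+-monoʳ-≤ (choose2 k) (bothAdj-off-uv≤s∸1 (λ e → p0u (sym e)) (∧-intro (~sym uN) (~sym (X⇒N (Xadj⇒X sp0))))))
      pw : ∀ w → w ≢ v → drop w ≤ g w
      pw w wv with ≡⊎≢ w u
      ... | inj₁ refl = ≤δ-at {u = u} _ (drop≤choose2 u)
      ... | inj₂ wu rewrite except-≢ {a = v} (except u (λ w → fromBool (bothAdj u p0 w))) wv | except-≢ {a = u}
          (λ w → fromBool (bothAdj u p0 w)) wu = ≤δ-off (choose2 k) _ wu (αβγ-split w wv wu fa fb fc)
        where
        fa : Xᵤ w ≡ true → drop w ≤ fromBool (bothAdj u p0 w)
        fa Kw rewrite α-drop≡0 w Kw = z≤n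
        fc : Xᵤ w ≡ false → adj G u w ≡ false → drop w ≤ fromBool (bothAdj u p0 w)
        fc Kw uw rewrite γ-drop≡0 k3 w wv wu Kw uw = z≤n
        fb : X w ≡ false → u ~ w → drop w ≤ fromBool (bothAdj u p0 w)
        fb Xw uw with ≡⊎≢ w w0
        ... | inj₁ refl = subst (λ z → drop w0 ≤ fromBool (bothAdj u z w0)) p1p0
            (Withβ.β-drop≤bothAdj w1 β₁.p0 β₁.w0v β₁.Xw0 β₁.uw0 β₁.sp0 β₁.p0u w0 w0v Xw0 uw0 (λ e → w1w0 (sym e)))
        ... | inj₂ ww0 = β-drop≤bothAdj w wv Xw uw ww0

  module Noβ (noB : ∀ w → (isβ w ∧ atLeast2 (kX w)) ≡ false) where
    β-drop≡0 : ∀ w → w ≢ v → X w ≡ false → u ~ w → drop w ≡ 0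
    β-drop≡0 w wv Xw uw = drop≡0 w (¬atLeast2⇒≤1 (kX w)
        (∧-false⇒false (isβ w) (atLeast2 (kX w)) (∧-intro (not-intro Xw) (∧-intro uw (not-intro (≢⇒eqb-false wv)))) (noB w)))

    drop≤-via-α : (h : V → ℕ) → (∀ w → w ≢ v → w ≢ u → Xᵤ w ≡ true → drop w ≤ h w) → ∀ w → w ≢ v → drop w ≤ δ u w (choose2 k) + h w
    drop≤-via-α h fa w wv with ≡⊎≢ w u
    ... | inj₁ refl = ≤δ-at {u = u} _ (drop≤choose2 u)
    ... | inj₂ wu = ≤δ-off (choose2 k) _ wu (αβγ-split w wv wu (fa w wv wu) fb fc)
      where
      fb : X w ≡ false → u ~ w → drop w ≤ h w
      fb Xw uw rewrite β-drop≡0 w wv Xw uw = z≤n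
      fc : Xᵤ w ≡ false → adj G u w ≡ false → drop w ≤ h w
      fc Kw uw rewrite γ-drop≡0 k3 w wv wu Kw uw = z≤n

    module Noβ-k≥4 (k4 : 4 ≤ k) where
      s-1≥2 : 2 ≤ s ∸ 1
      s-1≥2 = ∸-monoˡ-≤ 1 (≤-trans (s≤s (s≤s (s≤s z≤n))) (≤-trans k4 ks))

      goodRemoval : GoodRemoval X hX
      goodRemoval with find (λ w1 → Xᵤ w1 ∧ atLeast2 (kX w1))
      ... | inj₂ none = goodRemoval-by (λ w → δ u w (choose2 k) + 0) (drop≤-via-α (λ _ → 0) fa)
          (≤-trans (≤-reflexive (trans (sum-δ-+ u (choose2 k) (λ _ → 0))
          (trans (cong (choose2 k +_) (sum-replicate-zero (n G))) (+-identityʳ (choose2 k))))) (m≤m+n (choose2 k) (s ∸ 1)))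
        where
        fa : ∀ w → w ≢ v → w ≢ u → Xᵤ w ≡ true → drop w ≤ 0
        fa w wv wu Kw rewrite drop≡0 w (¬atLeast2⇒≤1 (kX w) (∧-false⇒false (Xᵤ w) (atLeast2 (kX w)) Kw (none w))) = z≤n
      ... | inj₁ (w1 , h1) with another-Xadj w1 u (atLeast2⇒2≤ _ (∧-conicalʳ (Xᵤ w1) _ h1))
      ...   | q1 , sq1 , q1u with find (λ w2 → Xᵤ w2 ∧ not (eqb w2 w1) ∧ atLeast2 (kX w2))
      ...     | inj₂ none2 = goodRemoval-by (λ w → δ u w (choose2 k) + δ w1 w (s ∸ 1)) (drop≤-via-α (λ w → δ w1 w (s ∸ 1)) fa)
          (≤-reflexive (sum-δ² u w1 (choose2 k) (s ∸ 1)))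
        where
        Kw1 : Xᵤ w1 ≡ true
        Kw1 = ∧-conicalˡ (Xᵤ w1) _ h1
        small : ∀ w → Xᵤ w ≡ true → w ≢ w1 → kX w ≤ 1
        small w Kw ww1 = ¬atLeast2⇒≤1 (kX w) (∧∧-false⇒false (Xᵤ w) (not (eqb w w1)) (atLeast2 (kX w)) Kw (not-intro (≢⇒eqb-false ww1)) (none2 w))
        fa : ∀ w → w ≢ v → w ≢ u → Xᵤ w ≡ true → drop w ≤ δ w1 w (s ∸ 1)
        fa w wv wu Kw with ≡⊎≢ w w1
        ... | inj₂ ww1 rewrite drop≡0 w (small w Kw ww1) = z≤n
        ... | inj₁ refl = ≤-trans (≤-trans (drop≤k∸1 w1 (count≤1 _ u g)) (k-1≤s-1 w1 wv)) (≤-reflexive (sym (δ-≡ w1 (s ∸ 1))))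
          where
          g : ∀ x → ((X x ∧ adj G w1 x) ∧ T x) ≡ true → x ≡ u
          g x hx with T-cases {x} (∧-conicalʳ (X x ∧ adj G w1 x) _ hx)
          ... | inj₂ e = e
          ... | inj₁ Kx' = ⊥-elim (1+n≰n (≤-trans (s≤s (count≥2 (Xadj x) (Xadj-intro uX (~sym (Xᵤ⇒adj Kx')))
              (Xadj-intro (Xᵤ⇒X Kw) (~sym (∧-conicalʳ (X x) _ (∧-conicalˡ _ _ hx)))) (λ e → Xᵤ⇒≢u Kw (sym e))))
                              (s≤s (small x Kx' (λ e → ~ne (∧-conicalʳ (X x) _ (∧-conicalˡ _ _ hx)) (sym e))))))
      ...     | inj₁ (w2 , h2) with another-Xadj w2 u (atLeast2⇒2≤ _ (∧-conicalʳ (not (eqb w2 w1)) _ (∧-conicalʳ (Xᵤ w2) _ h2)))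
      ...       | q2 , sq2 , q2u with true⊎false (adj G w1 w2)
      ...         | inj₁ e12 = goodRemoval-by (λ w → δ u w (choose2 k) + (δ w1 w 1 + δ w2 w 1)) (drop≤-via-α (λ w → δ w1 w 1 + δ w2 w 1) fa)
                       (≤-trans (≤-reflexive (trans (sum-δ-+ u (choose2 k) (λ w → δ w1 w 1 + δ w2 w 1))
                           (cong (choose2 k +_) (sum-δ² w1 w2 1 1)))) (+-monoʳ-≤ (choose2 k) s-1≥2))
        where
        Kw1 : Xᵤ w1 ≡ true
        Kw1 = ∧-conicalˡ (Xᵤ w1) _ h1
        Kw2 : Xᵤ w2 ≡ true
        Kw2 = ∧-conicalˡ (Xᵤ w2) _ h2
        w21 : w2 ≢ w1
        w21 e = true≢false (∧-conicalˡ _ _ (∧-conicalʳ (Xᵤ w2) _ h2)) (cong not (≡⇒eqb e))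
        c1 : kX w1 ≤ 2
        c1 = kX≤2-by w1 u w2 (λ q sq qu qw2 → α-Xadj-unique k4 Kw1 Kw2 e12 sq qu qw2)
        c2 : kX w2 ≤ 2
        c2 = kX≤2-by w2 u w1 (λ q sq qu qw1 → α-Xadj-unique k4 Kw2 Kw1 (~sym e12) sq qu qw1)
        fa : ∀ w → w ≢ v → w ≢ u → Xᵤ w ≡ true → drop w ≤ δ w1 w 1 + δ w2 w 1
        fa w wv wu Kw with ≡⊎≢ w w1 | ≡⊎≢ w w2
        ... | inj₁ refl | _ = ≤δ-at {u = w1} _ (drop≤1 w1 c1)
        ... | inj₂ _ | inj₁ refl = ≤δ-off 1 _ w21 (≤-trans (drop≤1 w2 c2) (≤-reflexive (sym (δ-≡ w2 1))))
        ... | inj₂ ww1 | inj₂ ww2 = ≤-trans (≤-reflexive (drop≡0 w (kX≤1-by w u hq))) z≤n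
          where
          hq : ∀ q → Xadj w q ≡ true → q ≢ u → ⊥
          hq q sq qu with ≡⊎≢ q w1
          ... | inj₁ refl = α-Xadj-unique k4 Kw1 Kw2 e12 (Xadj-intro (Xᵤ⇒X Kw) (~sym (Xadj⇒adj sq))) (Xᵤ⇒≢u Kw) ww2
          ... | inj₂ qw1 with private-neighbours-agree (λ e → X⇒v≢ (Xᵤ⇒X Kw1) (sym e)) wv (~sym (Xᵤ⇒adj Kw1)) (~sym (Xᵤ⇒adj Kw)) (λ e → ww1 (sym e))
                                (Xadj-intro (Xᵤ⇒X Kw2) e12) (Xᵤ⇒≢u Kw2) sq qu (λ e → ww2 (sym e)) qw1
          ...   | refl = α-Xadj-unique k4 Kw2 Kw1 (~sym e12) (Xadj-intro (Xᵤ⇒X Kw) (~sym (Xadj⇒adj sq))) (Xᵤ⇒≢u Kw) ww1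
      ...         | inj₂ n12 = goodRemoval-by (λ w → δ u w (choose2 k) + hh w) (drop≤-via-α hh fa)
                       (≤-trans (≤-reflexive (sum-δ-+ u (choose2 k) hh))
                           (+-monoʳ-≤ (choose2 k) (bothAdj-off-uv≤s∸1 (λ e → q1u (sym e)) (∧-intro (~sym uN) (~sym (X⇒N (Xadj⇒X sq1)))))))
        where
        Kw1 : Xᵤ w1 ≡ true
        Kw1 = ∧-conicalˡ (Xᵤ w1) _ h1
        Kw2 : Xᵤ w2 ≡ true
        Kw2 = ∧-conicalˡ (Xᵤ w2) _ h2
        w21 : w2 ≢ w1
        w21 e = true≢false (∧-conicalˡ _ _ (∧-conicalʳ (Xᵤ w2) _ h2)) (cong not (≡⇒eqb e))
        p : V
        p = q1
        hh : V → ℕ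
        hh = except v (except u (λ w → fromBool (bothAdj u p w)))
        nadj : ∀ {x} → Xadj w1 x ≡ true → x ≢ w2
        nadj sx e = true≢false (subst (λ z → adj G w1 z ≡ true) e (Xadj⇒adj sx)) n12
        nadj2 : ∀ {x} → Xadj w2 x ≡ true → x ≢ w1
        nadj2 sx e = true≢false (~sym (subst (λ z → adj G w2 z ≡ true) e (Xadj⇒adj sx))) n12
        q12 : q1 ≡ q2
        q12 = private-neighbours-agree (λ e → X⇒v≢ (Xᵤ⇒X Kw1) (sym e)) (λ e → X⇒v≢ (Xᵤ⇒X Kw2) (sym e)) (~sym (Xᵤ⇒adj Kw1)) (~sym (Xᵤ⇒adj Kw2))
            (λ e → w21 (sym e))
                sq1 q1u sq2 q2u (nadj sq1) (nadj2 sq2)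
        Kp : Xᵤ p ≡ false
        Kp with true⊎false (Xᵤ p)
        ... | inj₂ e = e
        ... | inj₁ Kp' = ⊥-elim (α-Xadj-unique k4 Kp' Kw1 (~sym (Xadj⇒adj sq1))
            (Xadj-intro (Xᵤ⇒X Kw2) (~sym (subst (λ z → w2 ~ z) (sym q12) (Xadj⇒adj sq2)))) (Xᵤ⇒≢u Kw2) w21)
        toP : ∀ w → Xᵤ w ≡ true → ∀ q → Xadj w q ≡ true → q ≢ u → q ≡ p
        toP w Kw q sq qu with ≡⊎≢ w w1
        ... | inj₁ refl = trans (private-neighbours-agree (λ e → X⇒v≢ (Xᵤ⇒X Kw1) (sym e)) (λ e → X⇒v≢ (Xᵤ⇒X Kw2) (sym e)) (~sym (Xᵤ⇒adj Kw1))
            (~sym (Xᵤ⇒adj Kw2)) (λ e → w21 (sym e))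
                sq qu sq2 q2u (nadj sq) (nadj2 sq2)) (sym q12)
        ... | inj₂ ww1 with true⊎false (adj G w w1)
        ...   | inj₁ aw = ⊥-elim (α-Xadj-unique k4 Kw1 Kw (~sym aw) sq1 q1u (λ e → true≢false (subst (λ z → Xᵤ z ≡ true) (sym e) Kw) Kp))
        ...   | inj₂ naw = private-neighbours-agree (λ e → X⇒v≢ (Xᵤ⇒X Kw) (sym e)) (λ e → X⇒v≢ (Xᵤ⇒X Kw1) (sym e)) (~sym (Xᵤ⇒adj Kw)) (~sym (Xᵤ⇒adj Kw1)) ww1
                sq qu sq1 q1u (λ e → true≢false (subst (λ z → adj G w z ≡ true) e (Xadj⇒adj sq)) naw)
                    (λ e → true≢false (subst (λ z → Xᵤ z ≡ true) (sym e) Kw) Kp)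
        fa : ∀ w → w ≢ v → w ≢ u → Xᵤ w ≡ true → drop w ≤ hh w
        fa w wv wu Kw rewrite except-≢ {a = v} (except u (λ w → fromBool (bothAdj u p w))) wv | except-≢ {a = u} (λ w → fromBool (bothAdj u p w)) wu =
          drop≤fromBool w _ (kX≤2-by w u p (λ q sq qu qp → qp (toP w Kw q sq qu))) g
          where
          g : 2 ≤ kX w → bothAdj u p w ≡ true
          g h with another-Xadj w u h
          ... | q , sq , qu = ∧-intro (Xᵤ⇒adj Kw) (~sym (subst (λ z → w ~ z) (toP w Kw q sq qu) (Xadj⇒adj sq)))

  goodRemoval-within : (budget : ℕ) → 2 * (s + 1) * budget ≤ M * (k + 1) → (g : V → ℕ) → (∀ w → w ≢ v → drop w ≤ g w) → sum g ≤ budget → GoodRemoval X hX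
  goodRemoval-within budget ar g pw sg = record { T = T ; Tne = ≤-trans (s≤s z≤n) (≤-reflexive (sym |X∩T|)) ; D = budget
     ; drops = ≤-trans (totalDrop≤ g pw) sg
     ; arith = subst (λ z → 2 * (s + 1) * budget ≤ M * z) (trans (+-comm k 1) (sym |X∩T|)) ar }

  -- The drop at w ∈ X ∩ N(u) = {w, y, z} when k = 3, given by the adjacency of w to y and to z.
  α-drop-bound : Bool → Bool → ℕ
  α-drop-bound true true = 3
  α-drop-bound true false = 1
  α-drop-bound false true = 1
  α-drop-bound false false = 0

  α-drop-bound-sum≤5 : ∀ x y z → (x ∧ y ∧ z) ≡ false → α-drop-bound x y + α-drop-bound x z + α-drop-bound y z ≤ 5
  α-drop-bound-sum≤5 true true true ()
  α-drop-bound-sum≤5 true true false _ = ≤-refl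
  α-drop-bound-sum≤5 true false true _ = ≤-refl
  α-drop-bound-sum≤5 true false false _ = s≤s (s≤s z≤n)
  α-drop-bound-sum≤5 false true true _ = ≤-refl
  α-drop-bound-sum≤5 false true false _ = s≤s (s≤s z≤n)
  α-drop-bound-sum≤5 false false true _ = s≤s (s≤s z≤n)
  α-drop-bound-sum≤5 false false false _ = z≤n

  sum-δ³ : ∀ (a b c : V) (x y z : ℕ) → sum (λ w → δ a w x + δ b w y + δ c w z) ≡ x + y + z
  sum-δ³ a b c x y z = trans (∑-distrib-+ (λ w → δ a w x + δ b w y) (λ w → δ c w z)) (cong₂ _+_ (sum-δ² a b x y) (sum-δ c z))

  module Noβ-k≡3 (noB : ∀ w → (isβ w ∧ atLeast2 (kX w)) ≡ false) (k3e : k ≡ 3) where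
    open Noβ noB

    choose2-k≡3 : choose2 k ≡ 3
    choose2-k≡3 = cong choose2 k3e

    goodRemoval-6[s+1]≤M : 6 * (s + 1) ≤ M → GoodRemoval X hX
    goodRemoval-6[s+1]≤M h6 = goodRemoval-within (3 + 9) (subst (λ z → 2 * (s + 1) * (3 + 9) ≤ M * (z + 1)) (sym k3e) (budget-u∈X-k≡3 s M h6))
                (λ w → δ u w (choose2 k) + fromBool (Xᵤ w) * 3) (drop≤-via-α (λ w → fromBool (Xᵤ w) * 3) fa) sg
      where
      fa : ∀ w → w ≢ v → w ≢ u → Xᵤ w ≡ true → drop w ≤ fromBool (Xᵤ w) * 3
      fa w wv wu Kw rewrite Kw = ≤-trans (drop≤choose2 w) (≤-trans (choose2-mono-≤ (kmax w wv)) (≤-reflexive choose2-k≡3))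
      sg : sum (λ w → δ u w (choose2 k) + fromBool (Xᵤ w) * 3) ≤ 3 + 9
      sg = ≤-reflexive (trans (sum-δ-+ u (choose2 k) (λ w → fromBool (Xᵤ w) * 3))
             (cong₂ _+_ choose2-k≡3 (trans (sum-cong-≗ (λ w → *-comm (fromBool (Xᵤ w)) 3)) (trans (sym (*-distribˡ-sum 3 (λ w → fromBool (Xᵤ w)))) (cong (3 *_) k3e)))))

    open ThreeElements (count≡3⇒three-elements Xᵤ k3e) renaming (Pa to Ka; Pb to Kb; Pc to Kc; only to allK)

    Xᵤ⇒≢v : ∀ {x} → Xᵤ x ≡ true → x ≢ v
    Xᵤ⇒≢v Kx' e = X⇒v≢ (Xᵤ⇒X Kx') (sym e)

    vb : ∀ {w y z} → Xᵤ w ≡ true → Xᵤ y ≡ true → Xᵤ z ≡ true → w ≢ y → w ≢ z → y ≢ z →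
         (∀ x → Xᵤ x ≡ true → (x ≡ w) ⊎ (x ≡ y) ⊎ (x ≡ z)) → (adj G w y ∨ adj G w z ∨ adj G y z) ≡ true →
         drop w ≤ α-drop-bound (adj G w y) (adj G w z)
    vb {w} {y} {z} Kw Ky Kz wy wz yz allw any with true⊎false (adj G w y) | true⊎false (adj G w z)
    ... | inj₁ e1 | inj₁ e2 rewrite e1 | e2 = ≤-trans (drop≤choose2 w) (≤-trans (choose2-mono-≤ (kmax w (Xᵤ⇒≢v Kw))) (≤-reflexive choose2-k≡3))
    ... | inj₁ e1 | inj₂ e2 rewrite e1 | e2 = drop≤1 w (kX≤2-by w u y h)
      where
      h : ∀ q → Xadj w q ≡ true → q ≢ u → q ≢ y → ⊥
      h q sq qu qy with true⊎false (Xᵤ q)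
      ... | inj₂ nK = α-Xadj-in-Xᵤ Kw Ky e1 sq qu nK
      ... | inj₁ Kq with allw q Kq
      ...   | inj₁ refl = ~ne (Xadj⇒adj sq) refl
      ...   | inj₂ (inj₁ e) = qy e
      ...   | inj₂ (inj₂ refl) = true≢false (Xadj⇒adj sq) e2
    ... | inj₂ e1 | inj₁ e2 rewrite e1 | e2 = drop≤1 w (kX≤2-by w u z h)
      where
      h : ∀ q → Xadj w q ≡ true → q ≢ u → q ≢ z → ⊥
      h q sq qu qz with true⊎false (Xᵤ q)
      ... | inj₂ nK = α-Xadj-in-Xᵤ Kw Kz e2 sq qu nK
      ... | inj₁ Kq with allw q Kq
      ...   | inj₁ refl = ~ne (Xadj⇒adj sq) refl
      ...   | inj₂ (inj₁ refl) = true≢false (Xadj⇒adj sq) e1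
      ...   | inj₂ (inj₂ e) = qz e
    ... | inj₂ e1 | inj₂ e2 rewrite e1 | e2 = ≤-reflexive (drop≡0 w (kX≤1-by w u h))
      where
      eyz : adj G y z ≡ true
      eyz = any
      h : ∀ q → Xadj w q ≡ true → q ≢ u → ⊥
      h q sq qu with true⊎false (Xᵤ q)
      ... | inj₁ Kq with allw q Kq
      ...   | inj₁ refl = ~ne (Xadj⇒adj sq) refl
      ...   | inj₂ (inj₁ refl) = true≢false (Xadj⇒adj sq) e1
      ...   | inj₂ (inj₂ refl) = true≢false (Xadj⇒adj sq) e2
      h q sq qu | inj₂ nK with private-neighbours-agree (Xᵤ⇒≢v Kw) (Xᵤ⇒≢v Ky) (~sym (Xᵤ⇒adj Kw)) (~sym (Xᵤ⇒adj Ky)) wy sq qu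
          (Xadj-intro (Xᵤ⇒X Kz) eyz) (Xᵤ⇒≢u Kz)
                                  (λ e → true≢false (subst (λ t → Xᵤ t ≡ true) (sym e) Ky) nK) (λ e → wz (sym e))
      ...   | refl = true≢false Kz nK

    goodRemoval-noK5-by : (g : V → ℕ) → (∀ w → w ≢ v → drop w ≤ g w) → sum g ≤ 3 + 5 → GoodRemoval X hX
    goodRemoval-noK5-by = goodRemoval-within (3 + 5) (subst (λ z → 2 * (s + 1) * (3 + 5) ≤ M * (z + 1)) (sym k3e) (budget-u∈X-k≡3-noK5 s M hM4))

    ≤5 : ∀ {x} (y : ℕ) → x ≤ y → y ≤ 5 → choose2 k + x ≤ 3 + 5
    ≤5 y h1 h2 = +-mono-≤ (≤-reflexive choose2-k≡3) (≤-trans h1 h2)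

    module Xᵤ-independent (Kadj : ∀ x y → Xᵤ x ≡ true → Xᵤ y ≡ true → adj G x y ≡ false) where
      notK : ∀ {w q} → Xᵤ w ≡ true → Xadj w q ≡ true → Xᵤ q ≡ false
      notK {w} {q} Kw sq with true⊎false (Xᵤ q)
      ... | inj₂ e = e
      ... | inj₁ Kq = ⊥-elim (true≢false (Xadj⇒adj sq) (Kadj w q Kw Kq))

      goodRemoval : GoodRemoval X hX
      goodRemoval with find (λ w1 → Xᵤ w1 ∧ atLeast2 (kX w1))
      ... | inj₂ none = goodRemoval-noK5-by (λ w → δ u w (choose2 k) + 0) (drop≤-via-α (λ _ → 0) fa)
              (≤-trans (≤-reflexive (sum-δ-+ u (choose2 k) (λ _ → 0))) (≤5 0 (≤-reflexive (sum-replicate-zero (n G))) z≤n))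
        where
        fa : ∀ w → w ≢ v → w ≢ u → Xᵤ w ≡ true → drop w ≤ 0
        fa w wv wu Kw rewrite drop≡0 w (¬atLeast2⇒≤1 (kX w) (∧-false⇒false (Xᵤ w) (atLeast2 (kX w)) Kw (none w))) = z≤n
      ... | inj₁ (w1 , h1) with another-Xadj w1 u (atLeast2⇒2≤ _ (∧-conicalʳ (Xᵤ w1) _ h1))
      ...   | q1 , sq1 , q1u with find (λ w2 → Xᵤ w2 ∧ not (eqb w2 w1) ∧ atLeast2 (kX w2))
      ...     | inj₂ none2 = goodRemoval-noK5-by (λ w → δ u w (choose2 k) + δ w1 w 2) (drop≤-via-α (λ w → δ w1 w 2) fa)
                  (≤-trans (≤-reflexive (sum-δ-+ u (choose2 k) (λ w → δ w1 w 2))) (≤5 2 (≤-reflexive (sum-δ w1 2)) (s≤s (s≤s z≤n))))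
        where
        Kw1 : Xᵤ w1 ≡ true
        Kw1 = ∧-conicalˡ (Xᵤ w1) _ h1
        fa : ∀ w → w ≢ v → w ≢ u → Xᵤ w ≡ true → drop w ≤ δ w1 w 2
        fa w wv wu Kw with ≡⊎≢ w w1
        ... | inj₂ ww1 rewrite drop≡0 w (¬atLeast2⇒≤1 (kX w)
            (∧∧-false⇒false (Xᵤ w) (not (eqb w w1)) (atLeast2 (kX w)) Kw (not-intro (≢⇒eqb-false ww1)) (none2 w))) = z≤n
        ... | inj₁ refl = ≤-trans (drop≤k∸1 w1 (count≤1 _ u g)) (≤-trans (∸-monoˡ-≤ 1 (≤-trans (kmax w1 wv) (≤-reflexive k3e))) (≤-reflexive (sym (δ-≡ w1 2))))
          where
          g : ∀ x → ((X x ∧ adj G w1 x) ∧ T x) ≡ true → x ≡ u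
          g x hx with T-cases {x} (∧-conicalʳ (X x ∧ adj G w1 x) _ hx)
          ... | inj₂ e = e
          ... | inj₁ Kx' = ⊥-elim (true≢false Kx' (notK Kw1 (∧-conicalˡ _ _ hx)))
      ...     | inj₁ (w2 , h2) with another-Xadj w2 u (atLeast2⇒2≤ _ (∧-conicalʳ (not (eqb w2 w1)) _ (∧-conicalʳ (Xᵤ w2) _ h2)))
      ...       | q2 , sq2 , q2u = goodRemoval-noK5-by (λ w → δ u w (choose2 k) + fromBool (Xᵤ w)) (drop≤-via-α (λ w → fromBool (Xᵤ w)) fa)
                    (≤-trans (≤-reflexive (sum-δ-+ u (choose2 k) (λ w → fromBool (Xᵤ w)))) (≤5 3 (≤-reflexive k3e) (s≤s (s≤s (s≤s z≤n)))))
        where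
        Kw1 : Xᵤ w1 ≡ true
        Kw1 = ∧-conicalˡ (Xᵤ w1) _ h1
        Kw2 : Xᵤ w2 ≡ true
        Kw2 = ∧-conicalˡ (Xᵤ w2) _ h2
        w21 : w2 ≢ w1
        w21 e = true≢false (∧-conicalˡ _ _ (∧-conicalʳ (Xᵤ w2) _ h2)) (cong not (≡⇒eqb e))
        nK≢ : ∀ {x y} → Xᵤ x ≡ true → Xᵤ y ≡ false → y ≢ x
        nK≢ Kx' nKy e = true≢false (subst (λ t → Xᵤ t ≡ true) (sym e) Kx') nKy
        q12 : q1 ≡ q2
        q12 = private-neighbours-agree (Xᵤ⇒≢v Kw1) (Xᵤ⇒≢v Kw2) (~sym (Xᵤ⇒adj Kw1)) (~sym (Xᵤ⇒adj Kw2)) (λ e → w21 (sym e)) sq1 q1u sq2 q2u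
                (nK≢ Kw2 (notK Kw1 sq1)) (nK≢ Kw1 (notK Kw2 sq2))
        toP : ∀ w → Xᵤ w ≡ true → ∀ q → Xadj w q ≡ true → q ≢ u → q ≡ q1
        toP w Kw q sq qu with ≡⊎≢ w w1
        ... | inj₁ refl = trans (private-neighbours-agree (Xᵤ⇒≢v Kw1) (Xᵤ⇒≢v Kw2) (~sym (Xᵤ⇒adj Kw1)) (~sym (Xᵤ⇒adj Kw2)) (λ e → w21 (sym e)) sq qu sq2 q2u
                (nK≢ Kw2 (notK Kw1 sq)) (nK≢ Kw1 (notK Kw2 sq2))) (sym q12)
        ... | inj₂ ww1 = private-neighbours-agree (Xᵤ⇒≢v Kw) (Xᵤ⇒≢v Kw1) (~sym (Xᵤ⇒adj Kw)) (~sym (Xᵤ⇒adj Kw1)) ww1 sq qu sq1 q1u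
                (nK≢ Kw1 (notK Kw sq)) (nK≢ Kw (notK Kw1 sq1))
        fa : ∀ w → w ≢ v → w ≢ u → Xᵤ w ≡ true → drop w ≤ fromBool (Xᵤ w)
        fa w wv wu Kw rewrite Kw = drop≤1 w (kX≤2-by w u q1 (λ q sq qu qp → qp (toP w Kw q sq qu)))

    module Xᵤ-some-edge (tri : (adj G a b ∧ adj G a c ∧ adj G b c) ≡ false) (anyE : (adj G a b ∨ adj G a c ∨ adj G b c) ≡ true) where
      fa fb fc : ℕ
      fa = α-drop-bound (adj G a b) (adj G a c)
      fb = α-drop-bound (adj G b a) (adj G b c)
      fc = α-drop-bound (adj G c a) (adj G c b)

      sab : adj G b a ≡ adj G a b
      sab = Graph.sym G b a
      sac : adj G c a ≡ adj G a c
      sac = Graph.sym G c a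
      sbc : adj G c b ≡ adj G b c
      sbc = Graph.sym G c b

      perm1 : ∀ x y z → (x ∨ y ∨ z) ≡ true → (x ∨ z ∨ y) ≡ true
      perm1 true y z h = refl
      perm1 false true z h = ∨-introʳ {z} refl
      perm1 false false true h = refl
      perm2 : ∀ x y z → (x ∨ y ∨ z) ≡ true → (y ∨ z ∨ x) ≡ true
      perm2 true y z h = ∨-introʳ {y} (∨-introʳ {z} refl)
      perm2 false true z h = refl
      perm2 false false true h = refl

      anyB : (adj G b a ∨ adj G b c ∨ adj G a c) ≡ true
      anyB rewrite sab = perm1 (adj G a b) (adj G a c) (adj G b c) anyE
      anyC : (adj G c a ∨ adj G c b ∨ adj G a b) ≡ true
      anyC rewrite sac | sbc = perm2 (adj G a b) (adj G a c) (adj G b c) anyE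

      sum5 : fa + fb + fc ≤ 5
      sum5 rewrite sab | sac | sbc = α-drop-bound-sum≤5 (adj G a b) (adj G a c) (adj G b c) tri

      pwK : ∀ w → Xᵤ w ≡ true → drop w ≤ δ a w fa + δ b w fb + δ c w fc
      pwK w Kw with allK w Kw
      ... | inj₁ refl rewrite δ-≢ {u = b} {w = a} fb a≢b | δ-≢ {u = c} {w = a} fc a≢c | δ-≡ a fa =
              ≤-trans (vb Ka Kb Kc a≢b a≢c b≢c allK anyE) (≤-reflexive (sym (trans (+-identityʳ _) (+-identityʳ _))))
      ... | inj₂ (inj₁ refl) rewrite δ-≢ {u = a} {w = b} fa (λ e → a≢b (sym e)) | δ-≢ {u = c} {w = b} fc b≢c | δ-≡ b fb =
              ≤-trans (vb Kb Ka Kc (λ e → a≢b (sym e)) b≢c a≢c allB anyB) (≤-reflexive (sym (+-identityʳ _)))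
        where
        allB : ∀ x → Xᵤ x ≡ true → (x ≡ b) ⊎ (x ≡ a) ⊎ (x ≡ c)
        allB x Kx' with allK x Kx'
        ... | inj₁ e = inj₂ (inj₁ e)
        ... | inj₂ (inj₁ e) = inj₁ e
        ... | inj₂ (inj₂ e) = inj₂ (inj₂ e)
      ... | inj₂ (inj₂ refl) rewrite δ-≢ {u = a} {w = c} fa (λ e → a≢c (sym e)) | δ-≢ {u = b} {w = c} fb (λ e → b≢c (sym e)) | δ-≡ c fc =
              vb Kc Ka Kb (λ e → a≢c (sym e)) (λ e → b≢c (sym e)) a≢b allC anyC
        where
        allC : ∀ x → Xᵤ x ≡ true → (x ≡ c) ⊎ (x ≡ a) ⊎ (x ≡ b)
        allC x Kx' with allK x Kx'
        ... | inj₁ e = inj₂ (inj₁ e)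
        ... | inj₂ (inj₁ e) = inj₂ (inj₂ e)
        ... | inj₂ (inj₂ e) = inj₁ e

      hh : V → ℕ
      hh w = δ a w fa + δ b w fb + δ c w fc

      goodRemoval : GoodRemoval X hX
      goodRemoval = goodRemoval-noK5-by (λ w → δ u w (choose2 k) + hh w) (drop≤-via-α hh (λ w _ _ Kw → pwK w Kw))
              (≤-trans (≤-reflexive (sum-δ-+ u (choose2 k) hh)) (≤5 (fa + fb + fc) (≤-reflexive (sum-δ³ a b c fa fb fc)) sum5))

    sel : ∀ x y z → ((x ≡ true) × (y ≡ true) × (z ≡ true)) ⊎ ((x ≡ false) × (y ≡ false) × (z ≡ false)) ⊎ (((x ∧ y ∧ z) ≡ false) × ((x ∨ y ∨ z) ≡ true))
    sel true true true = inj₁ (refl , refl , refl)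
    sel true true false = inj₂ (inj₂ (refl , refl))
    sel true false z = inj₂ (inj₂ (refl , refl))
    sel false true z = inj₂ (inj₂ (refl , refl))
    sel false false true = inj₂ (inj₂ (refl , refl))
    sel false false false = inj₂ (inj₁ (refl , refl , refl))

    goodRemoval-noK5 : ¬ Contains (K 5) G → GoodRemoval X hX
    goodRemoval-noK5 nk5 with sel (adj G a b) (adj G a c) (adj G b c)
    ... | inj₁ (eab , eac , ebc) = ⊥-elim (nk5 (clique⇒K5 uN (X⇒N (Xᵤ⇒X Ka)) (X⇒N (Xᵤ⇒X Kb)) (X⇒N (Xᵤ⇒X Kc)) (Xᵤ⇒adj Ka) (Xᵤ⇒adj Kb) (Xᵤ⇒adj Kc) eab eac ebc))
    ... | inj₂ (inj₂ (tri , anyE)) = Xᵤ-some-edge.goodRemoval tri anyE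
    ... | inj₂ (inj₁ (eab , eac , ebc)) = Xᵤ-independent.goodRemoval Kadj
      where
      Kadj : ∀ x y → Xᵤ x ≡ true → Xᵤ y ≡ true → adj G x y ≡ false
      Kadj x y Kx' Ky with allK x Kx' | allK y Ky
      ... | inj₁ refl | inj₁ refl = irrefl G a
      ... | inj₁ refl | inj₂ (inj₁ refl) = eab
      ... | inj₁ refl | inj₂ (inj₂ refl) = eac
      ... | inj₂ (inj₁ refl) | inj₁ refl = trans (Graph.sym G b a) eab
      ... | inj₂ (inj₁ refl) | inj₂ (inj₁ refl) = irrefl G b
      ... | inj₂ (inj₁ refl) | inj₂ (inj₂ refl) = ebc
      ... | inj₂ (inj₂ refl) | inj₁ refl = trans (Graph.sym G c a) eac
      ... | inj₂ (inj₂ refl) | inj₂ (inj₁ refl) = trans (Graph.sym G c b) ebc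
      ... | inj₂ (inj₂ refl) | inj₂ (inj₂ refl) = irrefl G c

  goodRemoval : ((6 * (s + 1) ≤ M) ⊎ ¬ Contains (K 5) G) → GoodRemoval X hX
  goodRemoval hK with find (λ w0 → isβ w0 ∧ atLeast2 (kX w0))
  ... | inj₁ (w0 , Bw0) = Someβ.goodRemoval w0 Bw0
  ... | inj₂ noB with k ≟ℕ 3
  ...   | yes k3e with hK
  ...     | inj₁ h6 = Noβ-k≡3.goodRemoval-6[s+1]≤M noB k3e h6
  ...     | inj₂ nk5 = Noβ-k≡3.goodRemoval-noK5 noB k3e nk5
  goodRemoval hK | inj₂ noB | no n3 = Noβ.Noβ-k≥4.goodRemoval noB (k≥4 k3 n3)
    where
    k≥4 : ∀ {x} → 3 ≤ x → x ≢ 3 → 4 ≤ x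
    k≥4 {suc zero} (s≤s ()) _
    k≥4 {suc (suc zero)} (s≤s (s≤s ())) _
    k≥4 {suc (suc (suc zero))} _ n = ⊥-elim (n refl)
    k≥4 {suc (suc (suc (suc x)))} _ _ = s≤s (s≤s (s≤s (s≤s z≤n)))

module Step-u∈X-k≡2 (G : Graph) (v : Fin (n G)) (s : ℕ) (noK2 : ¬ Contains (K2 (s + 1)) G) (noC6 : ¬ Contains C6 G) (M : ℕ)
          (s2 : 2 ≤ s) (hMs : (s ∸ 1) * (s + 2) ≤ M) (hM4 : 4 * (s + 1) ≤ M)
          (X : Fin (n G) → Bool) (hX : ∀ x → X x ≡ true → adj G v x ≡ true)
          (u : Fin (n G)) (uv : u ≢ v) (uX : X u ≡ true)
          (kmax : ∀ w → w ≢ v → Potential.kX G v s noK2 noC6 X hX w ≤ Potential.kX G v s noK2 noC6 X hX u)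
          (k2e : Potential.kX G v s noK2 noC6 X hX u ≡ 2) where
  open Step-u∈X G v s noK2 noC6 X hX u uv uX
  open Induction G v s noK2 noC6 M using (GoodRemoval)

  open TwoElements (count≡2⇒two-elements Xᵤ k2e) renaming (Pa to Ka; Pb to Kb; only to allK)

  Xᵤ⇒≢v : ∀ {x} → Xᵤ x ≡ true → x ≢ v
  Xᵤ⇒≢v Kx' e = X⇒v≢ (Xᵤ⇒X Kx') (sym e)

  kX≤2 : ∀ w → w ≢ v → kX w ≤ 2
  kX≤2 w wv = ≤-trans (kmax w wv) (≤-reflexive k2e)

  other-in-Xᵤ : ∀ y → Xᵤ y ≡ true → Σ V λ x → Xᵤ x ≡ true × x ≢ y
  other-in-Xᵤ y Ky with pick≢₁ Xᵤ (≤-reflexive (sym k2e)) y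
  ... | x , Kx' , yx = x , Kx' , (λ e → yx (sym e))

  bothAdj-from-Xᵤ : ∀ {w x1 y} → Xᵤ x1 ≡ true → Xᵤ y ≡ true → x1 ≢ y → w ~ x1 → w ~ y → bothAdj a b w ≡ true
  bothAdj-from-Xᵤ {w} {x1} {y} K1 Ky ne w1 wy with allK x1 K1 | allK y Ky
  ... | inj₁ refl | inj₁ refl = ⊥-elim (ne refl)
  ... | inj₁ refl | inj₂ refl = ∧-intro (~sym w1) (~sym wy)
  ... | inj₂ refl | inj₁ refl = ∧-intro (~sym wy) (~sym w1)
  ... | inj₂ refl | inj₂ refl = ⊥-elim (ne refl)

  γ-bothAdj : ∀ {w y x2} → w ≢ v → w ≢ u → Xᵤ w ≡ false → adj G u w ≡ false → Xᵤ y ≡ true → w ~ y → Xadj w x2 ≡ true → x2 ≢ y → bothAdj a b w ≡ true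
  γ-bothAdj {w} {y} {x2} wv wu Kw uw Ky wy sx2 x2y with other-in-Xᵤ y Ky
  ... | x1 , Kx1 , x1y with ≡⊎≢ x1 x2
  ...   | inj₁ refl = bothAdj-from-Xᵤ Kx1 Ky x1y (Xadj⇒adj sx2) wy
  ...   | inj₂ n12 = ⊥-elim (¬hexagon-via-v uv wv (X⇒N (Xᵤ⇒X Kx1)) (X⇒N (Xᵤ⇒X Ky)) (X⇒N (Xadj⇒X sx2)) (Xᵤ⇒adj Kx1) (Xᵤ⇒adj Ky) wy (Xadj⇒adj sx2)
            (λ e → wu (sym e)) x1y x2y n12 (λ e → true≢false (subst (λ t → Xᵤ t ≡ true) e Kx1) Kw)
            (λ e → true≢false (~sym (subst (λ t → w ~ t) e (Xadj⇒adj sx2))) uw))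

  bothAdj-ab-v : bothAdj a b v ≡ true
  bothAdj-ab-v = ∧-intro (~sym (X⇒N (Xᵤ⇒X Ka))) (~sym (X⇒N (Xᵤ⇒X Kb)))
  bothAdj-ab-u : bothAdj a b u ≡ true
  bothAdj-ab-u = ∧-intro (~sym (Xᵤ⇒adj Ka)) (~sym (Xᵤ⇒adj Kb))

  drop≤fromBool′ : (T0 : V → Bool) → ∀ w (P : Bool) → w ≢ v → (2 ≤ kX w → P ≡ true) → Removal.drop T0 w ≤ fromBool P
  drop≤fromBool′ T0 w P wv h with 2 ≤? kX w
  ... | yes q rewrite h q = Removal.drop≤1 T0 w (kX≤2 w wv)
  ... | no q rewrite Removal.drop≡0 T0 w (≤-pred (≰⇒> q)) = z≤n

  hasOutsideXadj : V → Bool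
  hasOutsideXadj w0 = positive (count (λ p → Xadj w0 p ∧ not (T p)))

  module βWithOutsideNb (w0 p : V) (w0v : w0 ≢ v) (Xw0 : X w0 ≡ false) (uw0 : u ~ w0) (sp : Xadj w0 p ≡ true) (Tp : T p ≡ false) where
    pu : p ≢ u
    pu e = true≢false (subst (λ t → T t ≡ true) (sym e) (∨-introʳ {Xᵤ u} (eqb-refl u))) Tp
    Kp : Xᵤ p ≡ false
    Kp with true⊎false (Xᵤ p)
    ... | inj₂ e = e
    ... | inj₁ e = ⊥-elim (true≢false (∨-introˡ e) Tp)

    T' : V → Bool
    T' x = T x ∨ eqb x p
    module Removal′ = Removal T'

    |X∩T′| : count (λ x → X x ∧ T' x) ≡ 4
    |X∩T′| = trans (count-point _ p (∧-intro (Xadj⇒X sp) (∨-introʳ {T p} (eqb-refl p)))) (cong suc (trans (count-ext _ _ g) (trans |X∩T| (cong suc k2e))))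
      where
      g : ∀ x → ((X x ∧ T' x) ∧ not (eqb x p)) ≡ (X x ∧ T x)
      g x with ≡⊎≢ x p
      ... | inj₁ refl rewrite eqb-refl p | Tp = ∧-zero (X p)
        where
        ∧-zero : ∀ z → (z ∧ true) ∧ false ≡ z ∧ false
        ∧-zero true = refl
        ∧-zero false = refl
      ... | inj₂ ne rewrite ≢⇒eqb-false ne with X x | T x
      ...   | true | true = refl
      ...   | true | false = refl
      ...   | false | _ = refl

    T'case : ∀ {x} → T' x ≡ true → (Xᵤ x ≡ true) ⊎ (x ≡ u) ⊎ (x ≡ p)
    T'case {x} h with ∨-elim {T x} h
    ... | inj₂ e = inj₂ (inj₂ (eqb⇒≡ e))
    ... | inj₁ e with T-cases {x} e
    ...   | inj₁ k' = inj₁ k'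
    ...   | inj₂ e' = inj₂ (inj₁ e')

    alphaZ : ∀ w → Xᵤ w ≡ true → kX w ≤ 1
    alphaZ w Kw = kX≤1-by w u h
      where
      h : ∀ q → Xadj w q ≡ true → q ≢ u → ⊥
      h q sq qu with ≡⊎≢ q p
      ... | inj₁ refl with other-in-Xᵤ w Kw
      ...   | x1 , Kx1 , x1w = ¬hexagon-in-N (X⇒N (Xᵤ⇒X Kx1)) (~sym (Xᵤ⇒adj Kx1)) uw0 (Xadj⇒adj sp) (~sym (Xadj⇒adj sq)) (X⇒N (Xᵤ⇒X Kw))
               (λ e → uv (sym e)) (λ e → w0v (sym e)) (λ e → X⇒v≢ (Xadj⇒X sp) e) (X≢¬X (Xᵤ⇒X Kx1) Xw0)
               (λ e → true≢false (subst (λ t → Xᵤ t ≡ true) e Kx1) Kp) x1w (λ e → pu (sym e)) (λ e → Xᵤ⇒≢u Kw (sym e)) (λ e → X≢¬X (Xᵤ⇒X Kw) Xw0 (sym e))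
      h q sq qu | inj₂ qp = qp (private-neighbours-agree (Xᵤ⇒≢v Kw) w0v (~sym (Xᵤ⇒adj Kw)) (~sym uw0) (λ e → X≢¬X (Xᵤ⇒X Kw) Xw0 e) sq qu sp pu
               (X≢¬X (Xadj⇒X sq) Xw0) (λ e → true≢false (subst (λ t → Xᵤ t ≡ true) (sym e) Kw) Kp))

    h1 h2 : V → ℕ
    h1 = except v (except u (λ w → fromBool (bothAdj u p w)))
    h2 = except v (except u (λ w → fromBool (bothAdj a b w)))

    pw : ∀ w → w ≢ v → Removal′.drop w ≤ δ u w 1 + (h1 w + h2 w)
    pw w wv with ≡⊎≢ w u
    ... | inj₁ refl = ≤δ-at {u = u} _ (Removal′.drop≤1 u (kX≤2 u uv))
    ... | inj₂ wu rewrite except-≢ {a = v} (except u (λ w → fromBool (bothAdj u p w))) wv | except-≢ {a = u} (λ w → fromBool (bothAdj u p w)) wu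
                        | except-≢ {a = v} (except u (λ w → fromBool (bothAdj a b w))) wv | except-≢ {a = u} (λ w → fromBool (bothAdj a b w)) wu =
          ≤δ-off 1 _ wu (αβγ-split w wv wu fa fb fc)
      where
      fa : Xᵤ w ≡ true → Removal′.drop w ≤ fromBool (bothAdj u p w) + fromBool (bothAdj a b w)
      fa Kw rewrite Removal′.drop≡0 w (alphaZ w Kw) = z≤n
      fb : X w ≡ false → u ~ w → Removal′.drop w ≤ fromBool (bothAdj u p w) + fromBool (bothAdj a b w)
      fb Xw uw = ≤-trans (bb (≡⊎≢ w w0)) (m≤m+n _ _)
        where
        bb : (w ≡ w0) ⊎ (w ≢ w0) → Removal′.drop w ≤ fromBool (bothAdj u p w)
        bb (inj₁ refl) = drop≤fromBool′ T' w (bothAdj u p w) wv (λ _ → ∧-intro uw0 (~sym (Xadj⇒adj sp)))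
        bb (inj₂ ww0) = drop≤fromBool′ T' w (bothAdj u p w) wv g
          where
          eqp : ∀ {q} → Xadj w q ≡ true → q ≢ u → q ≡ p
          eqp sq qu = private-neighbours-agree wv w0v (~sym uw) (~sym uw0) ww0 sq qu sp pu (X≢¬X (Xadj⇒X sq) Xw0) (X≢¬X (Xadj⇒X sp) Xw)
          g : 2 ≤ kX w → bothAdj u p w ≡ true
          g h with another-Xadj w u h
          ... | q , sq , qu = ∧-intro uw (~sym (subst (λ z → w ~ z) (eqp sq qu) (Xadj⇒adj sq)))
      fc : Xᵤ w ≡ false → adj G u w ≡ false → Removal′.drop w ≤ fromBool (bothAdj u p w) + fromBool (bothAdj a b w)
      fc Kw uw with Removal′.drop-cases w
      ... | inj₁ d0 rewrite d0 = z≤n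
      ... | inj₂ ((y , Xy , wy , T'y) , kw2) with T'case {y} T'y
      ...   | inj₂ (inj₁ refl) = ⊥-elim (true≢false (~sym wy) uw)
      ...   | inj₁ Ky with pick≢₁ (Xadj w) kw2 y
      ...     | x2 , sx2 , yx2 = ≤-trans (drop≤fromBool′ T' w (bothAdj a b w) wv (λ _ → γ-bothAdj wv wu Kw uw Ky wy sx2 (λ e → yx2 (sym e)))) (m≤n+m _ _)
      fc Kw uw | inj₂ ((y , Xy , wy , T'y) , kw2) | inj₂ (inj₂ refl) with pick≢₁ (Xadj w) kw2 p
      ...     | x2 , sx2 , px2 = ⊥-elim (¬hexagon-via-v wv w0v (X⇒N (Xadj⇒X sx2)) (X⇒N (Xadj⇒X sp)) uN (Xadj⇒adj sx2) wy (Xadj⇒adj sp) (~sym uw0)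
                 (λ e → true≢false (subst (λ t → adj G u t ≡ true) (sym e) uw0) uw) (λ e → px2 (sym e)) (λ e → pu (sym e))
                 (λ e → true≢false (~sym (subst (λ t → w ~ t) e (Xadj⇒adj sx2))) uw) (X≢¬X (Xadj⇒X sx2) Xw0) (λ e → wu (sym e)))

    goodRemoval : GoodRemoval X hX
    goodRemoval = record { T = T' ; Tne = ≤-trans (s≤s z≤n) (≤-reflexive (sym |X∩T′|)) ; D = 1 + (s ∸ 1) + (s ∸ 2)
                 ; drops = ≤-trans (Removal′.totalDrop≤ _ pw) (≤-trans (≤-reflexive (trans (sum-δ-+ u 1 (λ w → h1 w + h2 w)) (cong (1 +_) (∑-distrib-+ h1 h2))))
                     (≤-trans (+-monoʳ-≤ 1 (+-mono-≤ (bothAdj-off-uv≤s∸1 (λ e → pu (sym e)) (∧-intro (~sym uN) (~sym (X⇒N (Xadj⇒X sp)))))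
                         (bothAdj-off-uv≤s∸2 a≢b bothAdj-ab-v bothAdj-ab-u)))
                       (≤-reflexive (sym (+-assoc 1 (s ∸ 1) (s ∸ 2))))))
                 ; arith = subst (λ z → 2 * (s + 1) * (1 + (s ∸ 1) + (s ∸ 2)) ≤ M * z) (sym |X∩T′|) (budget-u∈X-k≡2-enlarged s M s2 hMs) }

  goodRemoval-by : (g : V → ℕ) → (∀ w → w ≢ v → drop w ≤ g w) → sum g ≤ s + 1 → GoodRemoval X hX
  goodRemoval-by g pw sg = record { T = T ; Tne = ≤-trans (s≤s z≤n) (≤-reflexive (sym |X∩T|)) ; D = s + 1
     ; drops = ≤-trans (totalDrop≤ g pw) sg
     ; arith = subst (λ z → 2 * (s + 1) * (s + 1) ≤ M * z) (sym (trans |X∩T| (cong suc k2e))) (budget-u∈X-k≡2 s M s2 hM4 hMs) }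

  P2K : ∀ {w x} → bothAdj a b w ≡ true → Xᵤ x ≡ true → w ~ x
  P2K {w} {x} h Kx' with allK x Kx'
  ... | inj₁ refl = ~sym (∧-conicalˡ _ _ h)
  ... | inj₂ refl = ~sym (∧-conicalʳ (adj G a w) _ h)

  s-2+2 : s ∸ 2 + 2 ≡ s
  s-2+2 = m∸n+n≡m s2

  module NoβWithOutsideNb (noB2 : ∀ w0 → (isβ w0 ∧ hasOutsideXadj w0) ≡ false) where
    inT : ∀ {w0 p} → w0 ≢ v → X w0 ≡ false → u ~ w0 → Xadj w0 p ≡ true → T p ≡ true
    inT {w0} {p} w0v Xw0 uw0 sp with true⊎false (T p)
    ... | inj₁ e = e
    ... | inj₂ e = ⊥-elim (zc (pos0 (∧-false⇒false (isβ w0) (hasOutsideXadj w0)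
        (∧-intro (not-intro Xw0) (∧-intro uw0 (not-intro (≢⇒eqb-false w0v)))) (noB2 w0))))
      where
      pos0 : ∀ {c} → positive c ≡ false → c ≡ 0
      pos0 {zero} _ = refl
      zc : count (λ q → Xadj w0 q ∧ not (T q)) ≡ 0 → ⊥
      zc h with count-point (λ q → Xadj w0 q ∧ not (T q)) p (∧-intro sp (not-intro e))
      ... | h2 = 1+n≰n (≤-trans (s≤s z≤n) (≤-reflexive (trans (sym h2) h)))

    module Someβ′ (w0 : V) (w0v : w0 ≢ v) (Xw0 : X w0 ≡ false) (uw0 : u ~ w0) (kw0 : 2 ≤ kX w0) where
      pp : Σ V λ q → Xadj w0 q ≡ true × q ≢ u
      pp = another-Xadj w0 u kw0
      p0 : V
      p0 = proj₁ pp
      sp0 : Xadj w0 p0 ≡ true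
      sp0 = proj₁ (proj₂ pp)
      p0u : p0 ≢ u
      p0u = proj₂ (proj₂ pp)
      Kp0 : Xᵤ p0 ≡ true
      Kp0 with T-cases (inT w0v Xw0 uw0 sp0)
      ... | inj₁ k' = k'
      ... | inj₂ e = ⊥-elim (p0u e)
      qq : Σ V λ x → Xᵤ x ≡ true × x ≢ p0
      qq = other-in-Xᵤ p0 Kp0
      q0 : V
      q0 = proj₁ qq
      Kq0 : Xᵤ q0 ≡ true
      Kq0 = proj₁ (proj₂ qq)
      q0p0 : q0 ≢ p0
      q0p0 = proj₂ (proj₂ qq)
      two : ∀ w → Xᵤ w ≡ true → (w ≡ p0) ⊎ (w ≡ q0)
      two w Kw with ≡⊎≢ w p0 | ≡⊎≢ w q0
      ... | inj₁ e | _ = inj₁ e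
      ... | inj₂ _ | inj₁ e = inj₂ e
      ... | inj₂ n1 | inj₂ n2 = ⊥-elim (1+n≰n (≤-trans (count≥3 Xᵤ Kp0 Kq0 Kw (λ e → q0p0 (sym e)) (λ e → n1 (sym e)) (λ e → n2 (sym e))) (≤-reflexive k2e)))

      e : Bool
      e = adj G p0 q0

      h : V → ℕ
      h = except v (except q0 (λ w → fromBool (bothAdj u p0 w)))

      g : V → ℕ
      g w = δ u w 1 + (δ p0 w (fromBool e) + δ q0 w (fromBool e)) + h w

      alphaB : ∀ w → w ≢ v → Xᵤ w ≡ true → drop w ≤ δ p0 w (fromBool e) + δ q0 w (fromBool e)
      alphaB w wv Kw with true⊎false e
      ... | inj₁ et with two w Kw
      ...   | inj₁ refl rewrite et = ≤δ-at {u = p0} _ (drop≤1 p0 (kX≤2 p0 wv))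
      ...   | inj₂ refl rewrite et = ≤δ-off 1 _ q0p0 (≤-trans (drop≤1 q0 (kX≤2 q0 wv)) (≤-reflexive (sym (δ-≡ q0 1))))
      alphaB w wv Kw | inj₂ ef = ≤-trans (≤-reflexive (drop≡0 w (kX≤1-by w u hq))) z≤n
        where
        hq : ∀ q → Xadj w q ≡ true → q ≢ u → ⊥
        hq q sq qu with true⊎false (Xᵤ q)
        ... | inj₁ Kq with two w Kw | two q Kq
        ...   | inj₁ refl | inj₁ refl = ~ne (Xadj⇒adj sq) refl
        ...   | inj₁ refl | inj₂ refl = true≢false (Xadj⇒adj sq) ef
        ...   | inj₂ refl | inj₁ refl = true≢false (trans (Graph.sym G p0 q0) (Xadj⇒adj sq)) ef
        ...   | inj₂ refl | inj₂ refl = ~ne (Xadj⇒adj sq) refl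
        hq q sq qu | inj₂ nKq with two w Kw
        ...   | inj₁ refl = ¬hexagon-in-N (X⇒N (Xadj⇒X sq)) (~sym (Xadj⇒adj sq)) (~sym (Xadj⇒adj sp0)) (~sym uw0) (Xᵤ⇒adj Kq0) (X⇒N (Xᵤ⇒X Kq0))
                 (λ e' → X⇒v≢ (Xᵤ⇒X Kp0) e') (λ e' → w0v (sym e')) (λ e' → uv (sym e')) (X≢¬X (Xadj⇒X sq) Xw0) qu
                 (λ e' → true≢false (subst (λ t → Xᵤ t ≡ true) (sym e') Kq0) nKq) p0u (λ e' → q0p0 (sym e')) (λ e' → X≢¬X (Xᵤ⇒X Kq0) Xw0 (sym e'))
        ...   | inj₂ refl = true≢false (subst (λ t → Xᵤ t ≡ true)
            (sym (private-neighbours-agree (Xᵤ⇒≢v Kq0) w0v (~sym (Xᵤ⇒adj Kq0)) (~sym uw0) (λ e' → X≢¬X (Xᵤ⇒X Kq0) Xw0 e')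
                 sq qu sp0 p0u (X≢¬X (Xadj⇒X sq) Xw0) (λ e' → q0p0 (sym e')))) Kp0) nKq

      pw : ∀ w → w ≢ v → drop w ≤ g w
      pw w wv with ≡⊎≢ w u
      ... | inj₁ refl = ≤-trans (≤δ-at {u = u} (δ p0 u (fromBool e) + δ q0 u (fromBool e)) (drop≤1 u (kX≤2 u uv))) (m≤m+n _ (h u))
      ... | inj₂ wu rewrite δ-≢ {u = u} {w = w} 1 wu = αβγ-split w wv wu fa fb fc
        where
        fa : Xᵤ w ≡ true → drop w ≤ δ p0 w (fromBool e) + δ q0 w (fromBool e) + h w
        fa Kw = ≤-trans (alphaB w wv Kw) (m≤m+n _ (h w))
        fb : X w ≡ false → u ~ w → drop w ≤ δ p0 w (fromBool e) + δ q0 w (fromBool e) + h w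
        fb Xw uw rewrite except-≢ {a = v} (except q0 (λ w → fromBool (bothAdj u p0 w))) wv | except-≢ {a = q0} (λ w → fromBool (bothAdj u p0 w))
            (λ e' → X≢¬X (Xᵤ⇒X Kq0) Xw (sym e')) =
          ≤-trans (bb (≡⊎≢ w w0)) (m≤n+m _ _)
          where
          bb : (w ≡ w0) ⊎ (w ≢ w0) → drop w ≤ fromBool (bothAdj u p0 w)
          bb (inj₁ refl) = drop≤fromBool′ T w (bothAdj u p0 w) wv (λ _ → ∧-intro uw0 (~sym (Xadj⇒adj sp0)))
          bb (inj₂ ww0) = drop≤fromBool′ T w (bothAdj u p0 w) wv gg
            where
            eqp : ∀ {q} → Xadj w q ≡ true → q ≢ u → q ≡ p0
            eqp sq qu = private-neighbours-agree wv w0v (~sym uw) (~sym uw0) ww0 sq qu sp0 p0u (X≢¬X (Xadj⇒X sq) Xw0) (X≢¬X (Xadj⇒X sp0) Xw)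
            gg : 2 ≤ kX w → bothAdj u p0 w ≡ true
            gg hh with another-Xadj w u hh
            ... | q , sq , qu = ∧-intro uw (~sym (subst (λ z → w ~ z) (eqp sq qu) (Xadj⇒adj sq)))
        fc : Xᵤ w ≡ false → adj G u w ≡ false → drop w ≤ δ p0 w (fromBool e) + δ q0 w (fromBool e) + h w
        fc Kw uw with drop-cases w
        ... | inj₁ d0 rewrite d0 = z≤n
        ... | inj₂ ((y , Xy , wy , Ty) , kw2) with T-cases {y} Ty
        ...   | inj₂ refl = ⊥-elim (true≢false (~sym wy) uw)
        ...   | inj₁ Ky with pick≢₁ (Xadj w) kw2 y
        ...     | x2 , sx2 , yx2 = ⊥-elim (¬hexagon-via-v wv w0v (X⇒N (Xᵤ⇒X Kq0)) (X⇒N (Xᵤ⇒X Kp0)) uN (P2K Pw Kq0) (P2K Pw Kp0) (Xadj⇒adj sp0) (~sym uw0)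
                   (λ e' → true≢false (subst (λ t → adj G u t ≡ true) (sym e') uw0) uw) q0p0 (λ e' → p0u (sym e')) (Xᵤ⇒≢u Kq0)
                   (X≢¬X (Xᵤ⇒X Kq0) Xw0) (λ e' → wu (sym e')))
          where
          Pw : bothAdj a b w ≡ true
          Pw = γ-bothAdj wv wu Kw uw Ky wy sx2 (λ e' → yx2 (sym e'))

      sg : sum g ≤ s + 1
      sg rewrite ∑-distrib-+ (λ w → δ u w 1 + (δ p0 w (fromBool e) + δ q0 w (fromBool e))) h
               | sum-δ-+ u 1 (λ w → δ p0 w (fromBool e) + δ q0 w (fromBool e))
               | ∑-distrib-+ (λ w → δ p0 w (fromBool e)) (λ w → δ q0 w (fromBool e))
               | sum-δ p0 (fromBool e) | sum-δ q0 (fromBool e) with true⊎false e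
      ... | inj₁ et rewrite et = ≤-trans (+-monoʳ-≤ 3 (≤-trans (≤-reflexive (sym (m+n∸n≡m _ 2))) (∸-monoˡ-≤ 2 (≤-trans (≤-reflexive
               (count-except₂ (bothAdj u p0) v q0 (∧-intro (~sym uN) (~sym (X⇒N (Xᵤ⇒X Kp0)))) (∧-intro (Xᵤ⇒adj Kq0) et)
                   (λ e' → X⇒v≢ (Xᵤ⇒X Kq0) e'))) (codegree≤s (λ e' → p0u (sym e')))))))
               (≤-reflexive (trans (+-comm 3 (s ∸ 2)) (trans (sym (+-assoc (s ∸ 2) 2 1)) (cong (_+ 1) s-2+2))))
      ... | inj₂ ef rewrite ef = ≤-trans (+-monoʳ-≤ 1 (≤-trans (sum-mono-≤ pwh) (≤-trans (≤-reflexive (sym (m+n∸n≡m _ 1)))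
               (∸-monoˡ-≤ 1 (≤-trans (≤-reflexive (count-except₁ (bothAdj u p0) v (∧-intro (~sym uN) (~sym (X⇒N (Xᵤ⇒X Kp0))))))
                   (codegree≤s (λ e' → p0u (sym e'))))))))
               (≤-trans (≤-reflexive (+-comm 1 (s ∸ 1))) (+-monoˡ-≤ 1 (m∸n≤m s 1)))
        where
        pwh : ∀ w → h w ≤ except v (λ w → fromBool (bothAdj u p0 w)) w
        pwh w with eqb w v | eqb w q0
        ... | true | _ = z≤n
        ... | false | true = z≤n
        ... | false | false = ≤-refl

      goodRemoval : GoodRemoval X hX
      goodRemoval = goodRemoval-by g pw sg

    module Noβ′ (noB1 : ∀ w0 → (isβ w0 ∧ atLeast2 (kX w0)) ≡ false) where
      h2 : V → ℕ
      h2 = except v (except u (λ w → fromBool (bothAdj a b w)))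
      g : V → ℕ
      g w = δ u w 1 + (fromBool (Xᵤ w) + h2 w)

      pw : ∀ w → w ≢ v → drop w ≤ g w
      pw w wv with ≡⊎≢ w u
      ... | inj₁ refl = ≤δ-at {u = u} _ (drop≤1 u (kX≤2 u uv))
      ... | inj₂ wu rewrite δ-≢ {u = u} {w = w} 1 wu | except-≢ {a = v} (except u (λ w → fromBool (bothAdj a b w))) wv | except-≢ {a = u}
          (λ w → fromBool (bothAdj a b w)) wu =
            αβγ-split w wv wu fa fb fc
        where
        fa : Xᵤ w ≡ true → drop w ≤ fromBool (Xᵤ w) + fromBool (bothAdj a b w)
        fa Kw rewrite Kw = ≤-trans (drop≤1 w (kX≤2 w wv)) (s≤s z≤n)
        fb : X w ≡ false → u ~ w → drop w ≤ fromBool (Xᵤ w) + fromBool (bothAdj a b w)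
        fb Xw uw rewrite drop≡0 w (¬atLeast2⇒≤1 (kX w)
            (∧-false⇒false (isβ w) (atLeast2 (kX w)) (∧-intro (not-intro Xw) (∧-intro uw (not-intro (≢⇒eqb-false wv)))) (noB1 w))) = z≤n
        fc : Xᵤ w ≡ false → adj G u w ≡ false → drop w ≤ fromBool (Xᵤ w) + fromBool (bothAdj a b w)
        fc Kw uw with drop-cases w
        ... | inj₁ d0 rewrite d0 = z≤n
        ... | inj₂ ((y , Xy , wy , Ty) , kw2) with T-cases {y} Ty
        ...   | inj₂ refl = ⊥-elim (true≢false (~sym wy) uw)
        ...   | inj₁ Ky with pick≢₁ (Xadj w) kw2 y
        ...     | x2 , sx2 , yx2 = ≤-trans (drop≤fromBool′ T w (bothAdj a b w) wv (λ _ → γ-bothAdj wv wu Kw uw Ky wy sx2 (λ e' → yx2 (sym e')))) (m≤n+m _ _)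

      sg : sum g ≤ s + 1
      sg rewrite sum-δ-+ u 1 (λ w → fromBool (Xᵤ w) + h2 w) | ∑-distrib-+ (λ w → fromBool (Xᵤ w)) h2 =
        ≤-trans (+-monoʳ-≤ 1 (+-mono-≤ (≤-reflexive k2e) (bothAdj-off-uv≤s∸2 a≢b bothAdj-ab-v bothAdj-ab-u)))
          (≤-reflexive (trans (+-comm 1 (2 + (s ∸ 2))) (cong (_+ 1) (trans (+-comm 2 (s ∸ 2)) s-2+2))))

      goodRemoval : GoodRemoval X hX
      goodRemoval = goodRemoval-by g pw sg

    goodRemoval : GoodRemoval X hX
    goodRemoval with find (λ w0 → isβ w0 ∧ atLeast2 (kX w0))
    ... | inj₂ noB1 = Noβ′.goodRemoval noB1
    ... | inj₁ (w0 , h0) = Someβ′.goodRemoval w0 w0v Xw0 uw0 (atLeast2⇒2≤ _ (∧-conicalʳ (isβ w0) _ h0))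
      where
      bw : isβ w0 ≡ true
      bw = ∧-conicalˡ (isβ w0) _ h0
      Xw0 : X w0 ≡ false
      Xw0 = not-elim (∧-conicalˡ (not (X w0)) _ bw)
      uw0 : u ~ w0
      uw0 = ∧-conicalˡ _ _ (∧-conicalʳ (not (X w0)) _ bw)
      w0v : w0 ≢ v
      w0v e = true≢false (∧-conicalʳ (adj G u w0) _ (∧-conicalʳ (not (X w0)) _ bw)) (cong not (≡⇒eqb e))

  goodRemoval : GoodRemoval X hX
  goodRemoval with find (λ w0 → isβ w0 ∧ hasOutsideXadj w0)
  ... | inj₂ noB2 = NoβWithOutsideNb.goodRemoval noB2
  ... | inj₁ (w0 , h0) with count-pos (λ p → Xadj w0 p ∧ not (T p)) (posc (hasOutsideXadj w0) refl (∧-conicalʳ (isβ w0) _ h0))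
    where
    posc : ∀ {c} (x : Bool) → x ≡ positive c → x ≡ true → 1 ≤ c
    posc {suc c} x _ _ = s≤s z≤n
    posc {zero} x e t = ⊥-elim (true≢false t e)
  ...   | p , hp = βWithOutsideNb.goodRemoval w0 p w0v Xw0 uw0 (∧-conicalˡ (Xadj w0 p) _ hp) (not-elim (∧-conicalʳ (Xadj w0 p) _ hp))
      where
      bw : isβ w0 ≡ true
      bw = ∧-conicalˡ (isβ w0) _ h0
      Xw0 : X w0 ≡ false
      Xw0 = not-elim (∧-conicalˡ (not (X w0)) _ bw)
      uw0 : u ~ w0
      uw0 = ∧-conicalˡ _ _ (∧-conicalʳ (not (X w0)) _ bw)
      w0v : w0 ≢ v
      w0v e = true≢false (∧-conicalʳ (adj G u w0) _ (∧-conicalʳ (not (X w0)) _ bw)) (cong not (≡⇒eqb e))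

-- Choice of the centre, and the theorem

argmax : ∀ {m} (f : Fin (suc m) → ℕ) → Σ (Fin (suc m)) λ u → ∀ w → f w ≤ f u
argmax {zero} f = zero , h
  where
  h : ∀ w → f w ≤ f zero
  h zero = ≤-refl
argmax {suc m} f with argmax (λ i → f (suc i))
... | u' , hu with f zero ≤? f (suc u')
...   | yes p = suc u' , h
  where
  h : ∀ w → f w ≤ f (suc u')
  h zero = p
  h (suc w) = hu w
...   | no p = zero , h
  where
  h : ∀ w → f w ≤ f zero
  h zero = ≤-refl
  h (suc w) = ≤-trans (hu w) (<⇒≤ (≰⇒> p))

argmax-inhabited : ∀ {m} (f : Fin m → ℕ) → Fin m → Σ (Fin m) λ u → ∀ w → f w ≤ f u
argmax-inhabited {suc m} f _ = argmax f

2*+bit≤⇒≤ : ∀ a b x y → x ≤ 1 → 2 * a + x ≤ 2 * b + y → y ≤ 1 → a ≤ b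
2*+bit≤⇒≤ a b x y hx h hy with a ≤? b
... | yes p = p
... | no p = ⊥-elim (1+n≰n (≤-trans (≤-trans (s≤s (+-monoʳ-≤ (2 * b) hy)) (≤-reflexive e)) (≤-trans (*-monoʳ-≤ 2 (≰⇒> p)) (≤-trans (m≤m+n (2 * a) x) h))))
  where
  e : suc (2 * b + 1) ≡ 2 * suc b
  e = trans (cong suc (+-comm (2 * b) 1)) (sym (*-suc 2 b))

2*+1≤2*⇒< : ∀ a b → 2 * a + 1 ≤ 2 * b + 0 → suc a ≤ b
2*+1≤2*⇒< a b h with suc a ≤? b
... | yes p = p
... | no p = ⊥-elim (1+n≰n (≤-trans (≤-trans (≤-reflexive (+-comm 1 (2 * a))) h) (≤-trans (≤-reflexive (+-identityʳ (2 * b))) (*-monoʳ-≤ 2 (≤-pred (≰⇒> p))))))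

module CentreChoice (G : Graph) (v : Fin (n G)) (s : ℕ) (noK2 : ¬ Contains (K2 (s + 1)) G) (noC6 : ¬ Contains C6 G) (M : ℕ)
          (s2 : 2 ≤ s) (hMs : (s ∸ 1) * (s + 2) ≤ M) (hM4 : 4 * (s + 1) ≤ M)
          (hK : (6 * (s + 1) ≤ M) ⊎ ¬ Contains (K 5) G) where
  open Induction G v s noK2 noC6 M

  goodRemovals : GoodRemovals
  goodRemovals X hX w0 w0v kw0 = go (true⊎false (X u))
    where
    kX : Fin (n G) → ℕ
    kX = Potential.kX G v s noK2 noC6 X hX
    -- u maximises kX and, among the maximisers, prefers vertices of X.
    score : Fin (n G) → ℕ
    score w = if eqb w v then 0 else suc (2 * kX w + fromBool (X w))
    am : Σ (Fin (n G)) λ u → ∀ w → score w ≤ score u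
    am = argmax-inhabited score w0
    u : Fin (n G)
    u = proj₁ am
    hu : ∀ w → score w ≤ score u
    hu = proj₂ am
    score-≢ : ∀ {w} → w ≢ v → score w ≡ suc (2 * kX w + fromBool (X w))
    score-≢ {w} ne rewrite ≢⇒eqb-false ne = refl
    uv : u ≢ v
    uv e with hu w0
    ... | h rewrite score-≢ w0v | e | eqb-refl v = 1+n≰n (≤-trans (s≤s z≤n) h)
    cmp : ∀ w → w ≢ v → 2 * kX w + fromBool (X w) ≤ 2 * kX u + fromBool (X u)
    cmp w wv = ≤-pred (subst₂ _≤_ (score-≢ wv) (score-≢ uv) (hu w))
    kmax : ∀ w → w ≢ v → kX w ≤ kX u
    kmax w wv = 2*+bit≤⇒≤ (kX w) (kX u) (fromBool (X w)) (fromBool (X u)) (fromBool≤1 (X w)) (cmp w wv) (fromBool≤1 (X u))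
    k2 : 2 ≤ kX u
    k2 = ≤-trans kw0 (kmax w0 w0v)
    go : (X u ≡ true) ⊎ (X u ≡ false) → GoodRemoval X hX
    go (inj₂ uX) = Step-u∉X.goodRemoval G v s noK2 noC6 M s2 hMs hM4 X hX u uv uX kmax pref k2
      where
      pref : ∀ x → X x ≡ true → suc (kX x) ≤ kX u
      pref x Xx = 2*+1≤2*⇒< (kX x) (kX u) (subst₂ _≤_ (cong (λ t → 2 * kX x + fromBool t) Xx) (cong (λ t → 2 * kX u + fromBool t) uX)
          (cmp x (λ e → true≢false (hX x Xx) (subst (λ t → adj G v t ≡ false) (sym e) (irrefl G v)))))
    go (inj₁ uX) with kX u ≟ℕ 2
    ... | yes k2e = Step-u∈X-k≡2.goodRemoval G v s noK2 noC6 M s2 hMs hM4 X hX u uv uX kmax k2e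
    ... | no n2 = Step-u∈X-k≥3.goodRemoval G v s noK2 noC6 M hMs hM4 X hX u uv uX kmax k2 (k3 k2 n2) hK
      where
      k3 : ∀ {x} → 2 ≤ x → x ≢ 2 → 3 ≤ x
      k3 {suc zero} (s≤s ()) _
      k3 {suc (suc zero)} _ n = ⊥-elim (n refl)
      k3 {suc (suc (suc x))} _ _ = s≤s (s≤s (s≤s z≤n))

c4Count-bound : ∀ s → 2 ≤ s → (G : Graph) → ¬ Contains (K2 (s + 1)) G → ¬ Contains C6 G → (v : Fin (n G)) →
                ∀ j → 2 ≤ j → 3 ≤ j ⊎ ¬ Contains (K 5) G →
                2 * (s + 1) * c4Count G v ≤ (2 * (s + 1) * (j * degree G v)) ⊔ ((s ∸ 1) * (s + 2) * degree G v)
c4Count-bound s 2≤s G noK2 noC6 v j 2≤j 3≤j⊎noK5 = begin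
  c * c4Count G v          ≤⟨ *-monoʳ-≤ c (FourCycles.c4Count≤Φ0 G v) ⟩
  c * FourCycles.Φ0 G v    ≤⟨ Induction.potential-bound G v s noK2 noC6 M goodRemovals (count (adj G v)) (adj G v) (λ _ h → h) ≤-refl ⟩
  M * count (adj G v)      ≡⟨ cong (M *_) (sym (degree-count G v)) ⟩
  M * d                    ≡⟨ *-distribʳ-⊔ d (c * j) P ⟩
  (c * j * d) ⊔ (P * d)    ≡⟨ cong (_⊔ (P * d)) (*-assoc c j d) ⟩
  (c * (j * d)) ⊔ (P * d)  ∎
  where
  open ≤-Reasoning
  c d P M : ℕ
  c = 2 * (s + 1)
  d = degree G v
  P = (s ∸ 1) * (s + 2)
  M = (c * j) ⊔ P
  2t[s+1]≤M : ∀ t → t ≤ j → 2 * t * (s + 1) ≤ M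
  2t[s+1]≤M t t≤j = begin
    2 * t * (s + 1)  ≡⟨ solve 2 (λ t s → con 2 :* t :* (s :+ con 1) := con 2 :* (s :+ con 1) :* t) refl t s ⟩
    c * t            ≤⟨ *-monoʳ-≤ c t≤j ⟩
    c * j            ≤⟨ m≤m⊔n (c * j) P ⟩
    M                ∎
  goodRemovals : Induction.GoodRemovals G v s noK2 noC6 M
  goodRemovals = CentreChoice.goodRemovals G v s noK2 noC6 M 2≤s (m≤n⊔m (c * j) P) (2t[s+1]≤M 2 2≤j) (map₁ (2t[s+1]≤M 3) 3≤j⊎noK5)

lemma1 : (s : ℕ) → 2 ≤ s → (G : Graph) →
    ¬ Contains (K2 (s + 1)) G → ¬ Contains C6 G → (v : Fin (n G)) →
    (2 * (s + 1) * c4Count G v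
        ≤ (2 * (s + 1) * (3 * degree G v)) ⊔ ((s ∸ 1) * (s + 2) * degree G v))
    × (¬ Contains (K 5) G →
       2 * (s + 1) * c4Count G v
        ≤ (2 * (s + 1) * (2 * degree G v)) ⊔ ((s ∸ 1) * (s + 2) * degree G v))
lemma1 s 2≤s G noK2 noC6 v =
  c4Count-bound s 2≤s G noK2 noC6 v 3 (s≤s (s≤s z≤n)) (inj₁ ≤-refl) ,
  λ noK5 → c4Count-bound s 2≤s G noK2 noC6 v 2 ≤-refl (inj₂ noK5)
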